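{- Let $\varphi=\frac{1+\sqrt5}{2}$, let $F=0100101001001010010\ldots$ be the Fibonacci word (the cutting sequence of the line $y=\varphi x$), and let $S^M=01020101020102010102\ldots$ be the ternary word obtained from $F$ by replacing every factor $00$ by $020$. Then $P(S^M,2k)=0$ for every integer $k\ge 1$, and $P(S^M,2k+1)=3$ for every integer $k\ge 0$.
   Context: The cutting sequence of a line $y=\lambda x$ ($\lambda>0$) is the binary word obtained by following the line from the origin and writing $0$ for each meeting with a horizontal grid line $y=k$ and $1$ for each meeting with a vertical grid line $x=k$ ($k$ a positive integer). A finite word $u=u_1\cdots u_n$ is a palindrome if $u_k=u_{n-k+1}$ for all $1\le k\le n$. For an infinite word $x$ and integer $n>0$, $P(x,n)$ is the number of distinct factors (blocks of consecutive letters) of $x$ of length $n$ that are palindromes. -}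

module Defs where

open import Data.Nat using (ℕ; zero; suc; _+_; _*_; _∸_; _^_; _<ᵇ_; _≤ᵇ_)
open import Data.Bool using (Bool; true; false; _∨_; if_then_else_)
open import Data.List using (List; []; _∷_; _++_; map; length; lookup)
open import Data.List.Base using (upTo)
open import Data.Fin using (Fin; opposite)
open import Data.Product using (Σ; ∃; _×_; _,_)
open import Data.List.Membership.Propositional using (_∈_)
open import Data.List.Relation.Unary.All using (All)
open import Data.List.Relation.Unary.Unique.Propositional using (Unique)
open import Relation.Binary.PropositionalEquality using (_≡_)

Word : Set
Word = ℕ → ℕ

-- Cutting sequence of y = φ x, φ = (1+√5)/2, computed exactly.
-- The line meets the horizontal grid line y = k (k ≥ 1) at x = k/φ and the
-- vertical grid line x = m (m ≥ 1) at x = m.  Since φ is irrational there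
-- are no ties.  k/φ < m  ⇔  k < mφ  ⇔  2k − m < m√5
--                       ⇔  2k ≤ m  ∨  (2k − m)² < 5m²   (for m ≥ 1).

-- horizontal meeting number k comes strictly before vertical meeting number m
hBeforeV : ℕ → ℕ → Bool
hBeforeV k m = ((2 * k) ≤ᵇ m) ∨ (((2 * k ∸ m) ^ 2) <ᵇ (5 * m ^ 2))

countH : ℕ → ℕ → ℕ
countH zero    m = 0
countH (suc N) m = (if hBeforeV (suc N) m then 1 else 0) + countH N m

-- every horizontal meeting before vertical meeting m has k < mφ < 2m,
-- so k ∈ {1,…,2m} covers all of them.
hBefore : ℕ → ℕ
hBefore m = countH (2 * m) m

-- 0-indexed position, in the cutting sequence, of the meeting with x = m
-- (m ≥ 1): preceded by the m−1 earlier vertical meetings and hBefore m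
-- horizontal ones.
posV : ℕ → ℕ
posV m = (m ∸ 1) + hBefore m

isVAt : ℕ → ℕ → Bool
isVAt n zero    = false
isVAt n (suc B) = (posV (suc B) Data.Nat.≡ᵇ n) ∨ isVAt n B

-- The cutting sequence of y = φx (letter n, 0-indexed): 1 for a vertical
-- meeting, 0 for a horizontal one.  (posV m ≥ m − 1, so only m ≤ n+1 can
-- sit at position n.)
F : Word
F n = if isVAt n (suc n) then 1 else 0

-- S^M : replace every factor 00 of F by 020, i.e. insert a 2 between every
-- two consecutive 0s of F.

block : ℕ → List ℕ
block i with F i Data.Nat.≡ᵇ 0 | F (suc i) Data.Nat.≡ᵇ 0
... | true | true = 0 ∷ 2 ∷ []
... | _    | _    = F i ∷ []

prefixS : ℕ → List ℕ
prefixS zero    = []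
prefixS (suc n) = prefixS n ++ block n

nth : List ℕ → ℕ → ℕ
nth []       _       = 0
nth (x ∷ xs) zero    = x
nth (x ∷ xs) (suc j) = nth xs j

-- prefixS (suc j) has length ≥ j+1, so this reads the j-th letter of S^M.
SM : Word
SM j = nth (prefixS (suc j)) j

factorAt : Word → ℕ → ℕ → List ℕ
factorAt x i n = map (λ j → x (i + j)) (upTo n)

IsFactor : Word → List ℕ → Set
IsFactor x w = ∃ λ i → factorAt x i (length w) ≡ w

Palindrome : List ℕ → Set
Palindrome u = (i : Fin (length u)) → lookup u i ≡ lookup u (opposite i)

PalFactor : Word → ℕ → List ℕ → Set
PalFactor x n w = (length w ≡ n) × IsFactor x w × Palindrome w

-- P(x,n) = c : there are exactly c distinct palindromic factors of length n,
-- i.e. a duplicate-free list of length c enumerating all of them.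
PalCount : Word → ℕ → ℕ → Set
PalCount x n c = Σ (List (List ℕ)) λ L →
  Unique L × All (PalFactor x n) L × (∀ w → PalFactor x n w → w ∈ L) × (length L ≡ c)

-- S^M = 0 (1 + F 0) 0 (1 + F 1) 0 …, because F is the fixed point of the
-- substitution 0 ↦ 01, 1 ↦ 0. Hence a factor of even length begins and ends
-- with letters of different parity, and an odd palindrome of S^M is the same
-- as a palindrome of F together with its centre letter 0, 1 or 2. F is the
-- Sturmian word F n = 2 + ⌊(n + 1) φ⌋ − ⌊(n + 2) φ⌋, so windows of F of equal
-- length contain numbers of 1s differing by at most one; this forces two
-- palindromes of equal length and centre to coincide. Conversely, since
-- fib (n + 1) / fib n are best approximations of φ, the prefixes of F of
-- length fib (n + 1) − 2 are palindromes, and their centres supply all three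
-- centre letters. Comparisons of integers with multiples of φ are decided
-- exactly in ℤ[φ].
module Submission where

module GoldenInteger where

  open import Data.Nat as ℕ using (ℕ; zero; suc; z≤n; s≤s)
  import Data.Nat.Properties as ℕ
  open import Data.Nat.GeneralisedArithmetic using (iterate)
  open import Data.Integer
    using (ℤ; +_; -[1+_]; 0ℤ; _+_; _-_; _*_; -_; _<_; _≤_; +<+; +≤+; ∣_∣)
  import Data.Integer.Properties as ℤ
  open import Data.Integer.Tactic.RingSolver using (solve-∀)
  open import Data.Product using (∃-syntax; _×_; _,_; proj₁)
  open import Data.Sum using (_⊎_; inj₁; inj₂)
  open import Data.Empty using (⊥; ⊥-elim)
  open import Relation.Binary.PropositionalEquality
    using (_≡_; refl; sym; trans; cong; cong₂; subst; subst₂)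

  0≤-* : ∀ {i j} → 0ℤ ≤ i → 0ℤ ≤ j → 0ℤ ≤ i * j
  0≤-* {+ m} {+ n} _ _ = subst (0ℤ ≤_) (ℤ.pos-* m n) (+≤+ z≤n)

  0<-* : ∀ {i j} → 0ℤ < i → 0ℤ < j → 0ℤ < i * j
  0<-* {+ suc m} {+ suc n} _ _ = +<+ (s≤s z≤n)
  0<-* {+ zero} (+<+ ())
  0<-* {+ suc m} {+ zero} _ (+<+ ())

  0≤-square : ∀ i → 0ℤ ≤ i * i
  0≤-square (+ n)    = subst (0ℤ ≤_) (ℤ.pos-* n n) (+≤+ z≤n)
  0≤-square -[1+ n ] = +≤+ z≤n

  0<-neg-asym : ∀ {i} → 0ℤ < i → 0ℤ < - i → ⊥
  0<-neg-asym {+ suc n} _ ()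
  0<-neg-asym {+ zero} (+<+ ())

  0≤-neg-asym : ∀ {i} → 0ℤ ≤ i → 0ℤ < - i → ⊥
  0≤-neg-asym {+ zero}  _ (+<+ ())
  0≤-neg-asym {+ suc n} _ ()

  0<-⇒< : ∀ {i j} → 0ℤ < j - i → i < j
  0<-⇒< {i} {j} 0<j-i = subst₂ _<_ (ℤ.+-identityˡ i) (lemma i j) (ℤ.+-monoˡ-< i 0<j-i)
    where lemma : ∀ i j → j - i + i ≡ j
          lemma = solve-∀

  0<⊎0≤- : ∀ i → 0ℤ < i ⊎ 0ℤ ≤ - i
  0<⊎0≤- (+ zero)  = inj₂ (+≤+ z≤n)
  0<⊎0≤- (+ suc n) = inj₁ (+<+ (s≤s z≤n))
  0<⊎0≤- -[1+ n ]  = inj₂ (+≤+ z≤n)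

  -- (a , b) stands for a + b φ
  ℤ[φ] : Set
  ℤ[φ] = ℤ × ℤ

  infixl 6 _⊕_
  infix  7 _·_

  _⊕_ : ℤ[φ] → ℤ[φ] → ℤ[φ]
  (a , b) ⊕ (c , d) = a + c , b + d

  ⊝_ : ℤ[φ] → ℤ[φ]
  ⊝ (a , b) = - a , - b

  _·_ : ℤ → ℤ[φ] → ℤ[φ]
  z · (a , b) = z * a , z * b

  -- φ (a + b φ) = b + (a + b) φ, since φ² = φ + 1
  φ·_ : ℤ[φ] → ℤ[φ]
  φ· (a , b) = b , a + b

  φ⁻¹·_ : ℤ[φ] → ℤ[φ]
  φ⁻¹· (a , b) = b - a , a

  Quadrant : ℤ[φ] → Set
  Quadrant (a , b) = 0ℤ ≤ a × 0ℤ ≤ b × 0ℤ < a + b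

  -- x > 0. Multiplying by φ scales a + b φ by φ and its conjugate a + b φ̄ by
  -- φ̄ = −1/φ, so a positive a + b φ eventually lands in the first quadrant.
  Pos : ℤ[φ] → Set
  Pos x = ∃[ n ] Quadrant (iterate φ·_ x n)

  Pos-≡ : ∀ {a b c d} → a ≡ c → b ≡ d → Pos (a , b) → Pos (c , d)
  Pos-≡ refl refl p = p

  Quadrant-φ· : ∀ x → Quadrant x → Quadrant (φ· x)
  Quadrant-φ· (a , b) (0≤a , 0≤b , 0<a+b) = 0≤b , ℤ.<⇒≤ 0<a+b , ℤ.+-mono-≤-< 0≤b 0<a+b

  iterate-φ· : ∀ n x → iterate φ·_ (φ· x) n ≡ φ· iterate φ·_ x n
  iterate-φ· zero    x = refl
  iterate-φ· (suc n) x = iterate-φ· n (φ· x)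

  Quadrant-iterate : ∀ k n x → Quadrant (iterate φ·_ x n) → Quadrant (iterate φ·_ x (k ℕ.+ n))
  Quadrant-iterate zero    n x q = q
  Quadrant-iterate (suc k) n x q = subst Quadrant (sym (iterate-φ· (k ℕ.+ n) x))
    (Quadrant-φ· _ (Quadrant-iterate k n x q))

  Quadrant-common : ∀ {x y} → Pos x → Pos y →
                    ∃[ n ] Quadrant (iterate φ·_ x n) × Quadrant (iterate φ·_ y n)
  Quadrant-common {x} {y} (n , qx) (m , qy) =
    m ℕ.+ n , Quadrant-iterate m n x qx ,
    subst (λ k → Quadrant (iterate φ·_ y k)) (ℕ.+-comm n m) (Quadrant-iterate n m y qy)

  φ·-⊕ : ∀ x y → φ· (x ⊕ y) ≡ φ· x ⊕ φ· y
  φ·-⊕ (a , b) (c , d) = cong (b + d ,_) (lemma a b c d)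
    where lemma : ∀ a b c d → a + c + (b + d) ≡ a + b + (c + d)
          lemma = solve-∀

  iterate-⊕ : ∀ n x y → iterate φ·_ (x ⊕ y) n ≡ iterate φ·_ x n ⊕ iterate φ·_ y n
  iterate-⊕ zero    x y = refl
  iterate-⊕ (suc n) x y = trans (cong (λ z → iterate φ·_ z n) (φ·-⊕ x y)) (iterate-⊕ n (φ· x) (φ· y))

  Quadrant-⊕ : ∀ x y → Quadrant x → Quadrant y → Quadrant (x ⊕ y)
  Quadrant-⊕ (a , b) (c , d) (0≤a , 0≤b , 0<a+b) (0≤c , 0≤d , 0<c+d) =
    ℤ.+-mono-≤ 0≤a 0≤c , ℤ.+-mono-≤ 0≤b 0≤d , subst (0ℤ <_) (lemma a b c d) (ℤ.+-mono-< 0<a+b 0<c+d)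
    where lemma : ∀ a b c d → a + b + (c + d) ≡ a + c + (b + d)
          lemma = solve-∀

  Pos-⊕ : ∀ {x y} → Pos x → Pos y → Pos (x ⊕ y)
  Pos-⊕ {x} {y} px py with Quadrant-common px py
  ... | n , qx , qy = n , subst Quadrant (sym (iterate-⊕ n x y)) (Quadrant-⊕ _ _ qx qy)

  Pos-φ· : ∀ {x} → Pos x → Pos (φ· x)
  Pos-φ· {x} (n , q) = n , subst Quadrant (sym (iterate-φ· n x)) (Quadrant-φ· _ q)

  Pos-φ⁻¹· : ∀ {x} → Pos x → Pos (φ⁻¹· x)
  Pos-φ⁻¹· {a , b} (n , q) =
    suc n , subst (λ z → Quadrant (iterate φ·_ z n)) (cong (a ,_) (sym (lemma a b))) q
    where lemma : ∀ a b → b - a + a ≡ b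
          lemma = solve-∀

  Pos-· : ∀ z {x} → 0ℤ < z → Pos x → Pos (z · x)
  Pos-· (+ zero) (+<+ ())
  Pos-· (+ suc zero) {a , b} _ p = Pos-≡ (sym (ℤ.*-identityˡ a)) (sym (ℤ.*-identityˡ b)) p
  Pos-· (+ suc (suc n)) {a , b} _ p =
    Pos-≡ (lemma (+ n) a) (lemma (+ n) b) (Pos-⊕ (Pos-· (+ suc n) (+<+ (s≤s z≤n)) p) p)
    where lemma : ∀ n a → (+ 1 + n) * a + a ≡ (+ 2 + n) * a
          lemma = solve-∀

  Pos-⊕-· : ∀ {z x y} → 0ℤ ≤ z → Pos x → Pos y → Pos (y ⊕ z · x)
  Pos-⊕-· {+ zero} {x} {c , d} _ _ py = Pos-≡ (sym (ℤ.+-identityʳ c)) (sym (ℤ.+-identityʳ d)) py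
  Pos-⊕-· {+ suc n} _ px py = Pos-⊕ py (Pos-· (+ suc n) (+<+ (s≤s z≤n)) px)

  φ·-⊝ : ∀ x → φ· (⊝ x) ≡ ⊝ φ· x
  φ·-⊝ (a , b) = cong (- b ,_) (sym (ℤ.neg-distrib-+ a b))

  iterate-⊝ : ∀ n x → iterate φ·_ (⊝ x) n ≡ ⊝ iterate φ·_ x n
  iterate-⊝ zero    x = refl
  iterate-⊝ (suc n) x = trans (cong (λ z → iterate φ·_ z n) (φ·-⊝ x)) (iterate-⊝ n (φ· x))

  Pos-asym : ∀ {x} → Pos x → Pos (⊝ x) → ⊥
  Pos-asym {x} px p⊝x with Quadrant-common px p⊝x
  ... | n , qx , q⊝x with iterate φ·_ x n | subst Quadrant (iterate-⊝ n x) q⊝x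
  ...   | (a , b) | (_ , _ , 0<-a-b) with qx
  ...     | (_ , _ , 0<a+b) = 0<-neg-asym 0<a+b (subst (0ℤ <_) (lemma a b) 0<-a-b)
    where lemma : ∀ a b → - a + - b ≡ - (a + b)
          lemma = solve-∀

  Mixed : ℤ[φ] → Set
  Mixed (a , b) = (0ℤ < a × 0ℤ < - b) ⊎ (0ℤ < - a × 0ℤ < b)

  size : ℤ[φ] → ℕ
  size (a , b) = ∣ a ∣ ℕ.+ ∣ b ∣

  data Classify (x : ℤ[φ]) : Set where
    origin   : x ≡ (0ℤ , 0ℤ) → Classify x
    quadrant : Quadrant x → Classify x
    opposite : Quadrant (⊝ x) → Classify x
    mixed    : Mixed x → Classify x

  classify : ∀ x → Classify x
  classify (+ zero  , + zero)   = origin refl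
  classify (+ zero  , + suc n)  = quadrant (+≤+ z≤n , +≤+ z≤n , +<+ (s≤s z≤n))
  classify (+ suc m , + n)      = quadrant (+≤+ z≤n , +≤+ z≤n , +<+ (s≤s z≤n))
  classify (+ zero  , -[1+ n ]) = opposite (+≤+ z≤n , +≤+ z≤n , +<+ (s≤s z≤n))
  classify (+ suc m , -[1+ n ]) = mixed (inj₁ (+<+ (s≤s z≤n) , +<+ (s≤s z≤n)))
  classify (-[1+ m ] , + zero)  = opposite (+≤+ z≤n , +≤+ z≤n , +<+ (s≤s z≤n))
  classify (-[1+ m ] , + suc n) = mixed (inj₂ (+<+ (s≤s z≤n) , +<+ (s≤s z≤n)))
  classify (-[1+ m ] , -[1+ n ]) = opposite (+≤+ z≤n , +≤+ z≤n , +<+ (s≤s z≤n))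

  ∣pos∣ : ∀ {i} → 0ℤ < i → + ∣ i ∣ ≡ i
  ∣pos∣ 0<i = ℤ.0≤i⇒+∣i∣≡i (ℤ.<⇒≤ 0<i)

  ∣neg∣ : ∀ {i} → 0ℤ < - i → + ∣ i ∣ ≡ - i
  ∣neg∣ {i} 0<-i = trans (cong +_ (sym (ℤ.∣-i∣≡∣i∣ i))) (∣pos∣ 0<-i)

  size-φ· : ∀ x → Mixed x → Mixed (φ· x) → size (φ· x) ℕ.< size x
  size-φ· (a , b) (inj₁ (_ , 0<-b)) (inj₁ (0<b , _)) = ⊥-elim (0<-neg-asym 0<b 0<-b)
  size-φ· (a , b) (inj₁ (0<a , 0<-b)) (inj₂ (_ , 0<a+b)) =
    ℤ.drop‿+<+ (0<-⇒< (subst (0ℤ <_) (sym (trans (cong₂ _-_ rhs lhs) (lemma a b))) 0<-b))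
    where
      lhs : + (∣ b ∣ ℕ.+ ∣ a + b ∣) ≡ - b + (a + b)
      lhs = trans (ℤ.pos-+ ∣ b ∣ ∣ a + b ∣) (cong₂ _+_ (∣neg∣ 0<-b) (∣pos∣ 0<a+b))
      rhs : + (∣ a ∣ ℕ.+ ∣ b ∣) ≡ a + - b
      rhs = trans (ℤ.pos-+ ∣ a ∣ ∣ b ∣) (cong₂ _+_ (∣pos∣ 0<a) (∣neg∣ 0<-b))
      lemma : ∀ a b → a + - b - (- b + (a + b)) ≡ - b
      lemma = solve-∀
  size-φ· (a , b) (inj₂ (_ , 0<b)) (inj₂ (0<-b , _)) = ⊥-elim (0<-neg-asym 0<b 0<-b)
  size-φ· (a , b) (inj₂ (0<-a , 0<b)) (inj₁ (_ , 0<-a-b)) =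
    ℤ.drop‿+<+ (0<-⇒< (subst (0ℤ <_) (sym (trans (cong₂ _-_ rhs lhs) (lemma a b))) 0<b))
    where
      lhs : + (∣ b ∣ ℕ.+ ∣ a + b ∣) ≡ b + - (a + b)
      lhs = trans (ℤ.pos-+ ∣ b ∣ ∣ a + b ∣) (cong₂ _+_ (∣pos∣ 0<b) (∣neg∣ 0<-a-b))
      rhs : + (∣ a ∣ ℕ.+ ∣ b ∣) ≡ - a + b
      rhs = trans (ℤ.pos-+ ∣ a ∣ ∣ b ∣) (cong₂ _+_ (∣neg∣ 0<-a) (∣pos∣ 0<b))
      lemma : ∀ a b → - a + b - (b + - (a + b)) ≡ b
      lemma = solve-∀

  φ·-mixed-nonzero : ∀ x → Mixed x → φ· x ≡ (0ℤ , 0ℤ) → ⊥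
  φ·-mixed-nonzero (a , b) (inj₁ (_ , 0<-b)) φx≡0 =
    ℤ.<-irrefl refl (subst (λ z → 0ℤ < - z) (cong proj₁ φx≡0) 0<-b)
  φ·-mixed-nonzero (a , b) (inj₂ (_ , 0<b))  φx≡0 =
    ℤ.<-irrefl refl (subst (0ℤ <_) (cong proj₁ φx≡0) 0<b)

  Trichotomous : ℤ[φ] → Set
  Trichotomous x = x ≡ (0ℤ , 0ℤ) ⊎ Pos x ⊎ Pos (⊝ x)

  -- Descent on the size of the mixed points reached by multiplying by φ.
  trichotomous-bounded : ∀ bound x → (Mixed x → size x ℕ.< bound) → Trichotomous x
  trichotomous-bounded bound x size<bound with classify x
  ... | origin x≡0   = inj₁ x≡0
  ... | quadrant q   = inj₂ (inj₁ (0 , q))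
  ... | opposite q   = inj₂ (inj₂ (0 , q))
  trichotomous-bounded zero x size<bound | mixed m with size<bound m
  ... | ()
  trichotomous-bounded (suc bound) x size<bound | mixed m
    with trichotomous-bounded bound (φ· x)
           (λ m′ → ℕ.<-≤-trans (size-φ· x m m′) (ℕ.≤-pred (size<bound m)))
  ... | inj₁ φx≡0             = ⊥-elim (φ·-mixed-nonzero x m φx≡0)
  ... | inj₂ (inj₁ (n , q))   = inj₂ (inj₁ (suc n , q))
  ... | inj₂ (inj₂ (n , q))   = inj₂ (inj₂ (suc n , subst (λ z → Quadrant (iterate φ·_ z n)) (sym (φ·-⊝ x)) q))

  trichotomous : ∀ x → Trichotomous x
  trichotomous x = trichotomous-bounded (suc (size x)) x (λ _ → ℕ.≤-refl)

module GoldenOrder where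

  open import Data.Nat as ℕ using (ℕ; zero; suc; z≤n; s≤s; _≤ᵇ_; _<ᵇ_)
  import Data.Nat.Properties as ℕ
  open import Data.Nat.Divisibility using (_∣_; divides)
  open import Data.Nat.Primality using (Prime; prime?; euclidsLemma)
  open import Data.Nat.Induction using (<-rec)
  open import Data.Nat.GeneralisedArithmetic using (iterate)
  import Data.Nat.Tactic.RingSolver as ℕSolver
  open import Data.Integer
    using (ℤ; +_; 0ℤ; _+_; _-_; _*_; -_; _<_; _≤_; +<+; +≤+)
  import Data.Integer.Properties as ℤ
  open import Data.Integer.Tactic.RingSolver using (solve-∀)
  open import Data.Bool using (true; false; T)
  open import Data.Product using (∃-syntax; _×_; _,_)
  open import Data.Sum using (_⊎_; inj₁; inj₂)
  open import Data.Empty using (⊥; ⊥-elim)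
  open import Relation.Nullary using (yes; no)
  open import Relation.Binary.Definitions using (tri<; tri≈; tri>)
  open import Relation.Nullary.Decidable using (from-yes)
  open import Relation.Binary.PropositionalEquality
    using (_≡_; refl; sym; trans; cong; cong₂; subst; subst₂; module ≡-Reasoning)
  open import Defs using (hBeforeV)
  open GoldenInteger

  5-prime : Prime 5
  5-prime = from-yes (prime? 5)

  5∣square⇒5∣ : ∀ n → 5 ∣ n ℕ.* n → ∃[ q ] n ≡ q ℕ.* 5
  5∣square⇒5∣ n 5∣n² with euclidsLemma n n 5-prime 5∣n²
  ... | inj₁ (divides q n≡q*5) = q , n≡q*5
  ... | inj₂ (divides q n≡q*5) = q , n≡q*5

  descend : ∀ b c q → c ≡ q ℕ.* 5 → c ℕ.* c ≡ 5 ℕ.* (b ℕ.* b) → b ℕ.* b ≡ 5 ℕ.* (q ℕ.* q)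
  descend b c q refl c²≡5b² = sym (ℕ.*-cancelˡ-≡ _ _ 5 (trans (lemma q) c²≡5b²))
    where lemma : ∀ q → 5 ℕ.* (5 ℕ.* (q ℕ.* q)) ≡ q ℕ.* 5 ℕ.* (q ℕ.* 5)
          lemma = ℕSolver.solve-∀

  quotient-< : ∀ r b → suc b ≡ r ℕ.* 5 → r ℕ.< suc b
  quotient-< zero    b _      = s≤s z≤n
  quotient-< (suc r) b b≡r*5 = subst (suc r ℕ.<_) (sym b≡r*5) (ℕ.m<m*n (suc r) 5 (s≤s (s≤s z≤n)))

  √5-irrational : ∀ b c → c ℕ.* c ≡ 5 ℕ.* (b ℕ.* b) → b ≡ 0
  √5-irrational = <-rec _ step
    where
      step : ∀ b → (∀ {r} → r ℕ.< b → ∀ q → q ℕ.* q ≡ 5 ℕ.* (r ℕ.* r) → r ≡ 0) →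
             ∀ c → c ℕ.* c ≡ 5 ℕ.* (b ℕ.* b) → b ≡ 0
      step zero    _   _ _ = refl
      step (suc b) rec c c²≡5b²
        with 5∣square⇒5∣ c (divides (suc b ℕ.* suc b) (trans c²≡5b² (ℕ.*-comm 5 (suc b ℕ.* suc b))))
      ... | q , c≡q*5
        with descend (suc b) c q c≡q*5 c²≡5b²
      ... | b²≡5q²
        with 5∣square⇒5∣ (suc b) (divides (q ℕ.* q) (trans b²≡5q² (ℕ.*-comm 5 (q ℕ.* q))))
      ... | r , b≡r*5 =
        trans b≡r*5 (cong (ℕ._* 5) (rec (quotient-< r b b≡r*5) q (descend q (suc b) r b≡r*5 b²≡5q²)))

  -- the norm (a + b φ)(a + b φ̄) = a² + a b − b²
  norm : ℤ[φ] → ℤ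
  norm (a , b) = a * a + a * b - b * b

  -- Necessary conditions for a + b φ > 0, in terms of the conjugate a + b φ̄:
  -- either the norm is ≥ 0 and the sum with the conjugate, 2a + b, is > 0, or
  -- the norm is ≤ 0 and the difference with the conjugate, √5 b, is > 0.
  NormSign : ℤ[φ] → Set
  NormSign (a , b) = (0ℤ ≤ norm (a , b) × 0ℤ < + 2 * a + b) ⊎ (0ℤ ≤ - norm (a , b) × 0ℤ < b)

  Quadrant⇒NormSign : ∀ x → Quadrant x → NormSign x
  Quadrant⇒NormSign (a , b) (0≤a , 0≤b , 0<a+b) with 0<⊎0≤- (- norm (a , b))
  ... | inj₂ 0≤--N = inj₁ (subst (0ℤ ≤_) (ℤ.neg-involutive _) 0≤--N ,
                          subst (0ℤ <_) (lemma a b) (ℤ.+-mono-≤-< 0≤a 0<a+b))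
    where lemma : ∀ a b → a + (a + b) ≡ + 2 * a + b
          lemma = solve-∀
  ... | inj₁ 0<-N with b | 0≤b
  ...   | + suc n | _ = inj₂ (ℤ.<⇒≤ 0<-N , +<+ (s≤s z≤n))
  ...   | + zero  | _ = ⊥-elim (0≤-neg-asym (subst (0ℤ ≤_) (sym (lemma a)) (0≤-square a)) 0<-N)
    where lemma : ∀ a → a * a + a * + 0 - + 0 * + 0 ≡ a * a
          lemma = solve-∀

  norm-φ· : ∀ a b → norm (φ· (a , b)) ≡ - norm (a , b)
  norm-φ· a b = lemma a b
    where lemma : ∀ a b → b * b + b * (a + b) - (a + b) * (a + b) ≡ - (a * a + a * b - b * b)
          lemma = solve-∀

  -- N(a , b) = t² + 5 t (−b) + 5 (−b)² for t = a + 3b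
  0<norm : ∀ a b → 0ℤ < + 2 * b + (a + b) → 0ℤ ≤ - b → 0ℤ < norm (a , b)
  0<norm a b 0<t 0≤-b = subst (0ℤ <_) (sym (lemma a b))
    (ℤ.+-mono-<-≤ (ℤ.+-mono-<-≤ (0<-* 0<t 0<t) (0≤-* (0≤-* {+ 5} (+≤+ z≤n) (ℤ.<⇒≤ 0<t)) 0≤-b))
             (0≤-* (0≤-* {+ 5} (+≤+ z≤n) 0≤-b) 0≤-b))
    where
      lemma : ∀ a b → a * a + a * b - b * b ≡
        (+ 2 * b + (a + b)) * (+ 2 * b + (a + b)) + + 5 * (+ 2 * b + (a + b)) * - b + + 5 * - b * - b
      lemma = solve-∀

  -- −N(a , b) = (−u) s + s² + b² for s = a + b and u = 2a + b
  0<-norm : ∀ a b → 0ℤ < a + b → 0ℤ ≤ - (+ 2 * a + b) → 0ℤ < - norm (a , b)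
  0<-norm a b 0<s 0≤-u = subst (0ℤ <_) (sym (lemma a b))
    (ℤ.+-mono-<-≤ (ℤ.+-mono-≤-< (0≤-* 0≤-u (ℤ.<⇒≤ 0<s)) (0<-* 0<s 0<s)) (0≤-square b))
    where
      lemma : ∀ a b → - (a * a + a * b - b * b) ≡ - (+ 2 * a + b) * (a + b) + (a + b) * (a + b) + b * b
      lemma = solve-∀

  NormSign-φ· : ∀ x → NormSign (φ· x) → NormSign x
  NormSign-φ· (a , b) (inj₁ (0≤N′ , 0<t)) with 0<⊎0≤- b
  ... | inj₁ 0<b  = inj₂ (subst (0ℤ ≤_) (norm-φ· a b) 0≤N′ , 0<b)
  ... | inj₂ 0≤-b = ⊥-elim (0≤-neg-asym (subst (0ℤ ≤_) (norm-φ· a b) 0≤N′)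
                       (subst (0ℤ <_) (sym (ℤ.neg-involutive _)) (0<norm a b 0<t 0≤-b)))
  NormSign-φ· (a , b) (inj₂ (0≤-N′ , 0<s)) with 0<⊎0≤- (+ 2 * a + b)
  ... | inj₁ 0<u  = inj₁ (0≤N , 0<u)
    where 0≤N = subst (0ℤ ≤_) (trans (cong -_ (norm-φ· a b)) (ℤ.neg-involutive _)) 0≤-N′
  ... | inj₂ 0≤-u = ⊥-elim (0≤-neg-asym 0≤N (0<-norm a b 0<s 0≤-u))
    where 0≤N = subst (0ℤ ≤_) (trans (cong -_ (norm-φ· a b)) (ℤ.neg-involutive _)) 0≤-N′

  Pos⇒NormSign : ∀ {x} → Pos x → NormSign x
  Pos⇒NormSign {x} (n , q) = go n x q
    where
      go : ∀ n x → Quadrant (iterate φ·_ x n) → NormSign x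
      go zero    x q = Quadrant⇒NormSign x q
      go (suc n) x q = NormSign-φ· x (go n (φ· x) q)

  infix 4 _<_·φ _·φ<_

  _<_·φ : ℕ → ℕ → Set
  k < m ·φ = Pos (- + k , + m)

  _·φ<_ : ℕ → ℕ → Set
  m ·φ< k = Pos (+ k , - + m)

  +∸ : ∀ {m n} → n ℕ.≤ m → + (m ℕ.∸ n) ≡ + m - + n
  +∸ {m} {n} n≤m = trans (sym (ℤ.⊖-≥ n≤m)) (sym (ℤ.m-n≡m⊖n m n))

  +-square : ∀ n → + n * + n ≡ + (n ℕ.* n)
  +-square n = sym (ℤ.pos-* n n)

  +5-square : ∀ n → + 5 * (+ n * + n) ≡ + (5 ℕ.* (n ℕ.* n))
  +5-square n = trans (cong (+ 5 *_) (+-square n)) (sym (ℤ.pos-* 5 (n ℕ.* n)))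

  -- Comparing k with M φ amounts to comparing (2k − M)² with 5 M².
  four-norm : ∀ k M → + 4 * norm (k , - M) ≡ (+ 2 * k - M) * (+ 2 * k - M) - + 5 * (M * M)
  four-norm k M = lemma k M
    where lemma : ∀ k M → + 4 * (k * k + k * - M - - M * - M) ≡ (+ 2 * k - M) * (+ 2 * k - M) - + 5 * (M * M)
          lemma = solve-∀

  norm-swap : ∀ k M → norm (- k , M) ≡ norm (k , - M)
  norm-swap k M = lemma k M
    where lemma : ∀ k M → - k * - k + - k * M - M * M ≡ k * k + k * - M - - M * - M
          lemma = solve-∀

  gap : ℕ → ℕ → ℕ
  gap k M = 2 ℕ.* k ℕ.∸ M

  +gap : ∀ k M → M ℕ.≤ 2 ℕ.* k → + 2 * + k - + M ≡ + gap k M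
  +gap k M M≤2k = trans (cong (_- + M) (sym (ℤ.pos-* 2 k))) (sym (+∸ M≤2k))

  four-norm-gap : ∀ k M → M ℕ.≤ 2 ℕ.* k →
                  + 4 * norm (+ k , - + M) ≡ + (gap k M ℕ.* gap k M) - + (5 ℕ.* (M ℕ.* M))
  four-norm-gap k M M≤2k = trans (four-norm (+ k) (+ M))
    (cong₂ _-_ (trans (cong₂ _*_ (+gap k M M≤2k) (+gap k M M≤2k)) (+-square (gap k M))) (+5-square M))

  NormSign-above : ∀ k M → NormSign (+ k , - + M) →
                   M ℕ.< 2 ℕ.* k × 5 ℕ.* (M ℕ.* M) ℕ.≤ gap k M ℕ.* gap k M
  NormSign-above k M (inj₂ (_ , 0<-M)) = ⊥-elim (0≤-neg-asym (+≤+ z≤n) 0<-M)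
  NormSign-above k M (inj₁ (0≤N , 0<2k-M)) =
    M<2k , ℤ.drop‿+≤+ (ℤ.0≤i-j⇒j≤i (subst (0ℤ ≤_) (four-norm-gap k M (ℕ.<⇒≤ M<2k)) (0≤-* {+ 4} (+≤+ z≤n) 0≤N)))
    where
      M<2k : M ℕ.< 2 ℕ.* k
      M<2k = ℤ.drop‿+<+ (subst (+ M <_) (sym (ℤ.pos-* 2 k)) (0<-⇒< 0<2k-M))

  NormSign-below : ∀ k M → NormSign (- + k , + M) →
                   2 ℕ.* k ℕ.< M ⊎ gap k M ℕ.* gap k M ℕ.≤ 5 ℕ.* (M ℕ.* M)
  NormSign-below k M (inj₁ (_ , 0<M-2k)) =
    inj₁ (ℤ.drop‿+<+ (0<-⇒< (subst (0ℤ <_) (trans (lemma (+ k) (+ M)) (cong (λ z → + M - z) (sym (ℤ.pos-* 2 k)))) 0<M-2k)))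
    where lemma : ∀ k M → + 2 * - k + M ≡ M - + 2 * k
          lemma = solve-∀
  NormSign-below k M (inj₂ (0≤-N , _)) with M ℕ.≤? 2 ℕ.* k
  ... | no  M≰2k = inj₁ (ℕ.≰⇒> M≰2k)
  ... | yes M≤2k = inj₂ (ℤ.drop‿+≤+ (ℤ.0≤i-j⇒j≤i (subst (0ℤ ≤_) eq (0≤-* {+ 4} (+≤+ z≤n) 0≤-N))))
    where
      eq : + 4 * - norm (- + k , + M) ≡ + (5 ℕ.* (M ℕ.* M)) - + (gap k M ℕ.* gap k M)
      eq = begin
        + 4 * - norm (- + k , + M)  ≡⟨ cong (λ z → + 4 * - z) (norm-swap (+ k) (+ M)) ⟩
        + 4 * - norm (+ k , - + M)  ≡⟨ lemma (norm (+ k , - + M)) ⟩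
        - (+ 4 * norm (+ k , - + M)) ≡⟨ cong -_ (four-norm-gap k M M≤2k) ⟩
        - (+ (gap k M ℕ.* gap k M) - + (5 ℕ.* (M ℕ.* M))) ≡⟨ lemma′ (+ (gap k M ℕ.* gap k M)) (+ (5 ℕ.* (M ℕ.* M))) ⟩
        + (5 ℕ.* (M ℕ.* M)) - + (gap k M ℕ.* gap k M) ∎
        where
          open ≡-Reasoning
          lemma : ∀ n → + 4 * - n ≡ - (+ 4 * n)
          lemma = solve-∀
          lemma′ : ∀ x y → - (x - y) ≡ y - x
          lemma′ = solve-∀

  square : ∀ x → x ℕ.^ 2 ≡ x ℕ.* x
  square x = cong (x ℕ.*_) (ℕ.*-identityʳ x)

  T-≡true : ∀ {b} → b ≡ true → T b
  T-≡true refl = _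

  hBeforeV-true : ∀ k m → hBeforeV k m ≡ true →
                  2 ℕ.* k ℕ.≤ m ⊎ gap k m ℕ.* gap k m ℕ.< 5 ℕ.* (m ℕ.* m)
  hBeforeV-true k m eq with 2 ℕ.* k ≤ᵇ m in 2k≤ᵇm
  ... | true  = inj₁ (ℕ.≤ᵇ⇒≤ _ _ (T-≡true 2k≤ᵇm))
  ... | false = inj₂ (subst₂ (λ a b → a ℕ.< 5 ℕ.* b) (square (gap k m)) (square m) (ℕ.<ᵇ⇒< _ _ (T-≡true eq)))

  hBeforeV-false : ∀ k m → hBeforeV k m ≡ false →
                   m ℕ.< 2 ℕ.* k × 5 ℕ.* (m ℕ.* m) ℕ.≤ gap k m ℕ.* gap k m
  hBeforeV-false k m eq with 2 ℕ.* k ≤ᵇ m in 2k≤ᵇm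
  ... | false = ℕ.≰⇒> (λ 2k≤m → subst T 2k≤ᵇm (ℕ.≤⇒≤ᵇ 2k≤m)) ,
                ℕ.≮⇒≥ (λ lt → subst T eq (subst₂ (λ a b → T (a <ᵇ 5 ℕ.* b)) (sym (square (gap k m))) (sym (square m)) (ℕ.<⇒<ᵇ lt)))

  hBeforeV-true⇒<·φ : ∀ k m → hBeforeV k (suc m) ≡ true → k < suc m ·φ
  hBeforeV-true⇒<·φ k m eq = case (trichotomous (- + k , + suc m))
    where
      case : Trichotomous (- + k , + suc m) → k < suc m ·φ
      case (inj₁ ())
      case (inj₂ (inj₁ k<Mφ)) = k<Mφ
      case (inj₂ (inj₂ Mφ<k))
        with NormSign-above k (suc m) (Pos⇒NormSign (Pos-≡ (ℤ.neg-involutive (+ k)) refl Mφ<k))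
           | hBeforeV-true k (suc m) eq
      ... | M<2k , _     | inj₁ 2k≤M     = ⊥-elim (ℕ.<⇒≱ M<2k 2k≤M)
      ... | _ , 5M²≤gap² | inj₂ gap²<5M² = ⊥-elim (ℕ.<⇒≱ gap²<5M² 5M²≤gap²)

  hBeforeV-false⇒·φ< : ∀ k m → hBeforeV k (suc m) ≡ false → suc m ·φ< k
  hBeforeV-false⇒·φ< k m eq = case (trichotomous (+ k , - + suc m))
    where
      case : Trichotomous (+ k , - + suc m) → suc m ·φ< k
      case (inj₁ ())
      case (inj₂ (inj₁ Mφ<k)) = Mφ<k
      case (inj₂ (inj₂ k<Mφ))
        with NormSign-below k (suc m) (Pos⇒NormSign (Pos-≡ refl (ℤ.neg-involutive (+ suc m)) k<Mφ))
           | hBeforeV-false k (suc m) eq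
      ... | inj₁ 2k<M     | M<2k , _ = ⊥-elim (ℕ.<-asym 2k<M M<2k)
      ... | inj₂ gap²≤5M² | _ , 5M²≤gap² =
        ⊥-elim (ℕ.1+n≢0 (√5-irrational (suc m) (gap k (suc m)) (ℕ.≤-antisym gap²≤5M² 5M²≤gap²)))

  <·φ-·φ<-asym : ∀ {k m} → k < m ·φ → m ·φ< k → ⊥
  <·φ-·φ<-asym k<mφ mφ<k = Pos-asym k<mφ (Pos-≡ (sym (ℤ.neg-involutive _)) refl mφ<k)

  +ℕ : ∀ {x} d → Pos x → Pos (x ⊕ (+ d , 0ℤ))
  +ℕ {a , b} zero    p = Pos-≡ (sym (ℤ.+-identityʳ a)) (sym (ℤ.+-identityʳ b)) p
  +ℕ         (suc d) p = Pos-⊕ p (0 , +≤+ z≤n , +≤+ z≤n , +<+ (s≤s z≤n))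

  ·φ<-≤ : ∀ {i j m} → i ℕ.≤ j → m ·φ< i → m ·φ< j
  ·φ<-≤ {i} {j} i≤j mφ<i = Pos-≡ (trans (cong (λ z → + i + z) (+∸ i≤j)) (lemma (+ i) (+ j))) (ℤ.+-identityʳ _)
    (+ℕ (j ℕ.∸ i) mφ<i)
    where lemma : ∀ i j → i + (j - i) ≡ j
          lemma = solve-∀

  <·φ-·φ<⇒< : ∀ {k l m} → k < m ·φ → m ·φ< l → k ℕ.< l
  <·φ-·φ<⇒< {k} {l} k<mφ mφ<l with ℕ.<-cmp k l
  ... | tri< k<l _ _ = k<l
  ... | tri≈ _ refl _ = ⊥-elim (<·φ-·φ<-asym k<mφ mφ<l)
  ... | tri> _ _ l<k = ⊥-elim (<·φ-·φ<-asym k<mφ (·φ<-≤ (ℕ.<⇒≤ l<k) mφ<l))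

  <·φ-+ : ∀ {k k′ m m′} → k < m ·φ → k′ < m′ ·φ → k ℕ.+ k′ < m ℕ.+ m′ ·φ
  <·φ-+ {k} {k′} {m} {m′} p q = Pos-≡
    (trans (sym (ℤ.neg-distrib-+ (+ k) (+ k′))) (cong -_ (sym (ℤ.pos-+ k k′)))) (sym (ℤ.pos-+ m m′))
    (Pos-⊕ p q)

  ·φ<-+ : ∀ {k k′ m m′} → m ·φ< k → m′ ·φ< k′ → m ℕ.+ m′ ·φ< k ℕ.+ k′
  ·φ<-+ {k} {k′} {m} {m′} p q = Pos-≡
    (sym (ℤ.pos-+ k k′)) (trans (sym (ℤ.neg-distrib-+ (+ m) (+ m′))) (cong -_ (sym (ℤ.pos-+ m m′))))
    (Pos-⊕ p q)

  <·φ-* : ∀ n {k m} → k < m ·φ → suc n ℕ.* k < suc n ℕ.* m ·φ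
  <·φ-* n {k} {m} p = Pos-≡ (trans (sym (ℤ.neg-distribʳ-* (+ suc n) (+ k))) (cong -_ (sym (ℤ.pos-* (suc n) k))))
    (sym (ℤ.pos-* (suc n) m)) (Pos-· (+ suc n) (+<+ (s≤s z≤n)) p)

  ·φ<-* : ∀ n {k m} → m ·φ< k → suc n ℕ.* m ·φ< suc n ℕ.* k
  ·φ<-* n {k} {m} p = Pos-≡ (sym (ℤ.pos-* (suc n) k))
    (trans (sym (ℤ.neg-distribʳ-* (+ suc n) (+ m))) (cong -_ (sym (ℤ.pos-* (suc n) m)))) (Pos-· (+ suc n) (+<+ (s≤s z≤n)) p)

  1<1·φ : 1 < 1 ·φ
  1<1·φ = 1 , +≤+ z≤n , +≤+ z≤n , +<+ (s≤s z≤n)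

  1·φ<2 : 1 ·φ< 2
  1·φ<2 = 2 , +≤+ z≤n , +≤+ z≤n , +<+ (s≤s z≤n)

  0<·φ : ∀ m → 0 < suc m ·φ
  0<·φ m = 0 , +≤+ z≤n , +≤+ z≤n , +<+ (s≤s z≤n)

  <·φ-suc : ∀ {k m} → k < m ·φ → suc k < suc m ·φ
  <·φ-suc {k} {m} p = Pos-≡ (lemma (+ k)) (ℤ.+-comm (+ m) (+ 1)) (Pos-⊕ p 1<1·φ)
    where lemma : ∀ k → - k + - + 1 ≡ - (+ 1 + k)
          lemma = solve-∀

  ·φ<-pred : ∀ {k m} → suc m ·φ< suc k → m ·φ< k
  ·φ<-pred {k} {m} p = Pos-≡ (lemma (+ k)) (lemma′ (+ m)) (Pos-⊕ p 1<1·φ)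
    where lemma : ∀ k → + 1 + k + - + 1 ≡ k
          lemma = solve-∀
          lemma′ : ∀ m → - (+ 1 + m) + + 1 ≡ - m
          lemma′ = solve-∀

  +[m+2j] : ∀ m j → + (m ℕ.+ 2 ℕ.* j) ≡ + m + + 2 * + j
  +[m+2j] m j = trans (ℤ.pos-+ m (2 ℕ.* j)) (cong (λ z → + m + z) (ℤ.pos-* 2 j))

  <·φ-φ⁻² : ∀ {j m} → j < m ·φ → m ℕ.+ 2 ℕ.* j < m ℕ.+ j ·φ
  <·φ-φ⁻² {j} {m} p = Pos-≡ (trans (lemma (+ j) (+ m)) (cong -_ (sym (+[m+2j] m j))))
    (trans (lemma′ (+ j) (+ m)) (sym (ℤ.pos-+ m j))) (Pos-φ⁻¹· (Pos-φ⁻¹· p))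
    where lemma : ∀ j m → - j - (m - - j) ≡ - (m + + 2 * j)
          lemma = solve-∀
          lemma′ : ∀ j m → m - - j ≡ m + j
          lemma′ = solve-∀

  <·φ-φ² : ∀ {j m} → m ℕ.+ 2 ℕ.* j < m ℕ.+ j ·φ → j < m ·φ
  <·φ-φ² {j} {m} p = Pos-≡ (lemma (+ j) (+ m)) (lemma′ (+ j) (+ m))
    (Pos-φ· (Pos-φ· (Pos-≡ (cong -_ (+[m+2j] m j)) (ℤ.pos-+ m j) p)))
    where lemma : ∀ j m → - (m + + 2 * j) + (m + j) ≡ - j
          lemma = solve-∀
          lemma′ : ∀ j m → m + j + (- (m + + 2 * j) + (m + j)) ≡ m
          lemma′ = solve-∀

  ·φ<-φ⁻² : ∀ {j m} → m ·φ< j → m ℕ.+ j ·φ< m ℕ.+ 2 ℕ.* j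
  ·φ<-φ⁻² {j} {m} p = Pos-≡ (trans (lemma (+ j) (+ m)) (sym (+[m+2j] m j)))
    (trans (lemma′ (+ j) (+ m)) (cong -_ (sym (ℤ.pos-+ m j)))) (Pos-φ⁻¹· (Pos-φ⁻¹· p))
    where lemma : ∀ j m → j - (- m - j) ≡ m + + 2 * j
          lemma = solve-∀
          lemma′ : ∀ j m → - m - j ≡ - (m + j)
          lemma′ = solve-∀

  ·φ<-φ² : ∀ {j m} → m ℕ.+ j ·φ< m ℕ.+ 2 ℕ.* j → m ·φ< j
  ·φ<-φ² {j} {m} p = Pos-≡ (lemma (+ j) (+ m)) (lemma′ (+ j) (+ m))
    (Pos-φ· (Pos-φ· (Pos-≡ (+[m+2j] m j) (cong -_ (ℤ.pos-+ m j)) p)))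
    where lemma : ∀ j m → m + + 2 * j + - (m + j) ≡ j
          lemma = solve-∀
          lemma′ : ∀ j m → - (m + j) + (m + + 2 * j + - (m + j)) ≡ - m
          lemma′ = solve-∀

  ·φ<-φ : ∀ {a m} → m ·φ< m ℕ.+ a → m < a ·φ
  ·φ<-φ {a} {m} p = Pos-≡ refl (trans (cong (_+ - + m) (ℤ.pos-+ m a)) (lemma (+ a) (+ m))) (Pos-φ· p)
    where lemma : ∀ a m → m + a + - m ≡ a
          lemma = solve-∀

  <·φ-φ : ∀ {a m} → m ℕ.+ a < m ·φ → a ·φ< m
  <·φ-φ {a} {m} p = Pos-≡ refl (trans (cong (λ z → - z + + m) (ℤ.pos-+ m a)) (lemma (+ a) (+ m))) (Pos-φ· p)
    where lemma : ∀ a m → - (m + a) + m ≡ - a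
          lemma = solve-∀

  3<2·φ : 3 < 2 ·φ
  3<2·φ = 3 , +≤+ z≤n , +≤+ z≤n , +<+ (s≤s z≤n)

module Floor where

  open import Data.Nat using (ℕ; zero; suc; _+_; _*_; _≤_; _<_; z≤n; s≤s)
  import Data.Nat.Properties as ℕ
  open import Data.Bool using (true; false)
  open import Data.Product using (_×_; _,_; proj₁; proj₂)
  open import Data.Sum using (_⊎_; inj₁; inj₂)
  open import Data.Empty using (⊥-elim)
  open import Relation.Binary.PropositionalEquality
    using (_≡_; refl; sym; cong; subst; subst₂)
  open import Defs using (hBeforeV; countH; hBefore)
  open GoldenOrder

  n<n·φ : ∀ n → suc n < suc n ·φ
  n<n·φ n = subst₂ _<_·φ (ℕ.*-identityʳ (suc n)) (ℕ.*-identityʳ (suc n)) (<·φ-* n 1<1·φ)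

  n·φ<2n : ∀ n → suc n ·φ< 2 * suc n
  n·φ<2n n = subst₂ _·φ<_ (ℕ.*-identityʳ (suc n)) (ℕ.*-comm (suc n) 2) (·φ<-* n 1·φ<2)

  countH-≤ : ∀ N m → countH N m ≤ N
  countH-≤ zero    m = z≤n
  countH-≤ (suc N) m with hBeforeV (suc N) m
  ... | true  = s≤s (countH-≤ N m)
  ... | false = ℕ.m≤n⇒m≤1+n (countH-≤ N m)

  -- countH N M = min N ⌊M φ⌋
  countH-bounds : ∀ N m → countH N (suc m) < suc m ·φ ×
                  (countH N (suc m) ≡ N ⊎ suc m ·φ< suc (countH N (suc m)))
  countH-bounds zero    m = 0<·φ m , inj₁ refl
  countH-bounds (suc N) m with hBeforeV (suc N) (suc m) in before | countH-bounds N m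
  ... | true  | _ , inj₁ c≡N = subst (_< suc m ·φ) (cong suc (sym c≡N)) (hBeforeV-true⇒<·φ (suc N) m before) ,
                               inj₁ (cong suc c≡N)
  ... | true  | _ , inj₂ Mφ<c+1 = ⊥-elim (<·φ-·φ<-asym (hBeforeV-true⇒<·φ (suc N) m before)
                                     (·φ<-≤ (s≤s (countH-≤ N (suc m))) Mφ<c+1))
  ... | false | c<Mφ , inj₁ c≡N =
    c<Mφ , inj₂ (subst (λ c → suc m ·φ< suc c) (sym c≡N) (hBeforeV-false⇒·φ< (suc N) m before))
  ... | false | c<Mφ , inj₂ Mφ<c+1 = c<Mφ , inj₂ Mφ<c+1

  -- Opaque: unfolding hBefore, a count, makes type checking very slow.
  opaque
    ⌊_·φ⌋ : ℕ → ℕ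
    ⌊ m ·φ⌋ = hBefore m

    ⌊⌋≡hBefore : ∀ m → ⌊ m ·φ⌋ ≡ hBefore m
    ⌊⌋≡hBefore m = refl

    ⌊1·φ⌋≡1 : ⌊ 1 ·φ⌋ ≡ 1
    ⌊1·φ⌋≡1 = refl

    ⌊⌋-bounds : ∀ m → ⌊ suc m ·φ⌋ < suc m ·φ × suc m ·φ< suc ⌊ suc m ·φ⌋
    ⌊⌋-bounds m with countH-bounds (2 * suc m) m
    ... | ⌊⌋<Mφ , inj₂ Mφ<⌊⌋+1 = ⌊⌋<Mφ , Mφ<⌊⌋+1
    ... | ⌊⌋<Mφ , inj₁ ⌊⌋≡2M  = ⊥-elim (<·φ-·φ<-asym (subst (_< suc m ·φ) ⌊⌋≡2M ⌊⌋<Mφ) (n·φ<2n m))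

  ⌊⌋-between : ∀ n → suc n ≤ ⌊ suc n ·φ⌋ × ⌊ suc n ·φ⌋ < 2 * suc n
  ⌊⌋-between n = ℕ.≤-pred (<·φ-·φ<⇒< (n<n·φ n) (proj₂ (⌊⌋-bounds n))) ,
                 <·φ-·φ<⇒< (proj₁ (⌊⌋-bounds n)) (n·φ<2n n)

  ⌊⌋-unique : ∀ {j m} → j < suc m ·φ → suc m ·φ< suc j → ⌊ suc m ·φ⌋ ≡ j
  ⌊⌋-unique {j} {m} j<Mφ Mφ<j+1 = ℕ.≤-antisym
    (ℕ.≤-pred (<·φ-·φ<⇒< (proj₁ (⌊⌋-bounds m)) Mφ<j+1))
    (ℕ.≤-pred (<·φ-·φ<⇒< j<Mφ (proj₂ (⌊⌋-bounds m))))

  ⌊⌋-+-bounds : ∀ x y → ⌊ suc x ·φ⌋ + ⌊ suc y ·φ⌋ < suc x + suc y ·φ ×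
                        suc x + suc y ·φ< suc ⌊ suc x ·φ⌋ + suc ⌊ suc y ·φ⌋
  ⌊⌋-+-bounds x y = <·φ-+ (proj₁ (⌊⌋-bounds x)) (proj₁ (⌊⌋-bounds y)) ,
                    ·φ<-+ (proj₂ (⌊⌋-bounds x)) (proj₂ (⌊⌋-bounds y))

  ⌊⌋-+ : ∀ x y → ⌊ suc x ·φ⌋ + ⌊ suc y ·φ⌋ ≤ ⌊ suc x + suc y ·φ⌋ ×
                 ⌊ suc x + suc y ·φ⌋ ≤ suc (⌊ suc x ·φ⌋ + ⌊ suc y ·φ⌋)
  ⌊⌋-+ x y =
    ℕ.≤-pred (<·φ-·φ<⇒< (proj₁ (⌊⌋-+-bounds x y)) (proj₂ (⌊⌋-bounds (x + suc y)))) ,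
    subst (⌊ suc x + suc y ·φ⌋ ≤_) (ℕ.+-suc _ _)
      (ℕ.≤-pred (<·φ-·φ<⇒< (proj₁ (⌊⌋-bounds (x + suc y))) (proj₂ (⌊⌋-+-bounds x y))))

  ⌊⌋-step-bounds : ∀ t → suc ⌊ suc t ·φ⌋ ≤ ⌊ 2 + t ·φ⌋ × ⌊ 2 + t ·φ⌋ ≤ 2 + ⌊ suc t ·φ⌋
  ⌊⌋-step-bounds t =
    subst (λ a → a + ⌊ suc t ·φ⌋ ≤ ⌊ 2 + t ·φ⌋) ⌊1·φ⌋≡1 (proj₁ (⌊⌋-+ 0 t)) ,
    subst (λ a → ⌊ 2 + t ·φ⌋ ≤ suc (a + ⌊ suc t ·φ⌋)) ⌊1·φ⌋≡1 (proj₂ (⌊⌋-+ 0 t))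

  ⌊⌋-step : ∀ t → ⌊ 2 + t ·φ⌋ ≡ suc ⌊ suc t ·φ⌋ ⊎ ⌊ 2 + t ·φ⌋ ≡ 2 + ⌊ suc t ·φ⌋
  ⌊⌋-step t with ⌊⌋-step-bounds t
  ... | lower , upper with ℕ.m≤n⇒m<n∨m≡n upper
  ...   | inj₁ below = inj₁ (ℕ.≤-antisym (ℕ.≤-pred below) lower)
  ...   | inj₂ top   = inj₂ top

module CuttingSequence where

  open import Data.Nat using (ℕ; suc; _+_; _*_; _∸_; _≤_; _<_; s≤s; _≡ᵇ_)
  import Data.Nat.Properties as ℕ
  import Data.Nat.Tactic.RingSolver as ℕSolver
  open import Data.Bool using (true; false; if_then_else_; T)
  open import Data.Product using (∃-syntax; _×_; _,_; proj₁; proj₂)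
  open import Data.Sum using (_⊎_; inj₁; inj₂)
  open import Data.Empty using (⊥-elim)
  open import Relation.Binary.PropositionalEquality
    using (_≡_; refl; sym; trans; cong; cong₂; subst; subst₂)
  open import Defs using (posV; isVAt; F)
  open GoldenOrder
  open Floor

  isVAt-sound : ∀ n B → isVAt n B ≡ true → ∃[ m ] m < B × posV (suc m) ≡ n
  isVAt-sound n (suc B) at with posV (suc B) ≡ᵇ n in here
  ... | true  = B , ℕ.≤-refl , ℕ.≡ᵇ⇒≡ (posV (suc B)) n (subst T (sym here) _)
  ... | false with isVAt-sound n B at
  ...   | m , m<B , posV≡n = m , ℕ.m≤n⇒m≤1+n m<B , posV≡n

  isVAt-complete : ∀ n B m → m < B → posV (suc m) ≡ n → isVAt n B ≡ true
  isVAt-complete n (suc B) m m<B posV≡n with posV (suc B) ≡ᵇ n in here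
  ... | true  = refl
  ... | false with ℕ.m≤n⇒m<n∨m≡n (ℕ.≤-pred m<B)
  ...   | inj₁ m<B′  = isVAt-complete n B m m<B′ posV≡n
  ...   | inj₂ refl = ⊥-elim (subst T here (ℕ.≡⇒≡ᵇ (posV (suc B)) n posV≡n))

  posV≡ : ∀ m → posV (suc m) ≡ m + ⌊ suc m ·φ⌋
  posV≡ m = cong (m +_) (sym (⌊⌋≡hBefore (suc m)))

  vertical⇒step : ∀ m n → posV (suc m) ≡ n → ⌊ 2 + n ·φ⌋ ≡ suc ⌊ suc n ·φ⌋
  vertical⇒step m n posV≡n = subst (λ n → ⌊ 2 + n ·φ⌋ ≡ suc ⌊ suc n ·φ⌋) (trans (sym (posV≡ m)) posV≡n) step
    where
      j = ⌊ suc m ·φ⌋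
      below : suc m + 2 * j < suc m + j ·φ
      below = <·φ-φ⁻² (proj₁ (⌊⌋-bounds m))
      above′ : suc (suc m + j) ·φ< suc (suc (suc m + 2 * j))
      above′ = subst₂ _·φ<_ (ℕ.+-suc (suc m) j) (lemma m j) (·φ<-φ⁻² (proj₂ (⌊⌋-bounds m)))
        where lemma : ∀ m j → suc m + 2 * suc j ≡ suc (suc (suc m + 2 * j))
              lemma = ℕSolver.solve-∀
      above : suc m + j ·φ< suc (suc m + 2 * j)
      above = ·φ<-pred above′
      step : ⌊ 2 + (m + j) ·φ⌋ ≡ suc ⌊ suc (m + j) ·φ⌋
      step = trans (⌊⌋-unique (<·φ-suc below) above′) (cong suc (sym (⌊⌋-unique below above)))

  split-between : ∀ {u K} → u ≤ K → K < 2 * u → ∃[ m ] ∃[ j ] u ≡ suc m + j × K ≡ suc m + 2 * j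
  split-between {u} {K} u≤K K<2u = u ∸ suc j , j , sym u≡ , trans (sym K≡) (trans (cong (_+ j) (sym u≡)) (lemma (u ∸ suc j) j))
    where
      j = K ∸ u
      K≡ : u + j ≡ K
      K≡ = ℕ.m+[n∸m]≡n u≤K
      j<u : j < u
      j<u = ℕ.+-cancelˡ-< u j u (subst₂ _<_ (sym K≡) (cong (u +_) (ℕ.+-identityʳ u)) K<2u)
      u≡ : suc (u ∸ suc j) + j ≡ u
      u≡ = trans (sym (ℕ.+-suc (u ∸ suc j) j)) (ℕ.m∸n+n≡m j<u)
      lemma : ∀ m j → suc m + j + j ≡ suc m + 2 * j
      lemma = ℕSolver.solve-∀

  step⇒vertical : ∀ n → ⌊ 2 + n ·φ⌋ ≡ suc ⌊ suc n ·φ⌋ → isVAt n (suc n) ≡ true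
  step⇒vertical n step with split-between (proj₁ (⌊⌋-between n)) (proj₂ (⌊⌋-between n))
  ... | m , j , u≡ , K≡ = isVAt-complete n (suc n) m m<u posV≡n
    where
      j<Mφ : j < suc m ·φ
      j<Mφ = <·φ-φ² (subst₂ _<_·φ K≡ u≡ (proj₁ (⌊⌋-bounds n)))
      Mφ<j+1 : suc m ·φ< suc j
      Mφ<j+1 = ·φ<-φ² (subst₂ _·φ<_ (trans (cong suc u≡) (sym (ℕ.+-suc (suc m) j)))
                         (trans (cong suc (trans step (cong suc K≡))) (lemma m j)) (proj₂ (⌊⌋-bounds (suc n))))
        where lemma : ∀ m j → suc (suc (suc m + 2 * j)) ≡ suc m + 2 * suc j
              lemma = ℕSolver.solve-∀
      posV≡n : posV (suc m) ≡ n
      posV≡n = trans (posV≡ m) (ℕ.suc-injective (trans (cong (λ z → suc (m + z)) (⌊⌋-unique j<Mφ Mφ<j+1)) (sym u≡)))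
      m<u : m < suc n
      m<u = subst (m <_) (sym u≡) (s≤s (ℕ.m≤m+n m j))

  F-floor : ∀ n → F n + ⌊ 2 + n ·φ⌋ ≡ 2 + ⌊ suc n ·φ⌋
  F-floor n with ⌊⌋-step n
  ... | inj₁ step = cong₂ _+_ (cong (λ b → if b then 1 else 0) (step⇒vertical n step)) step
  ... | inj₂ jump = cong₂ _+_ (cong (λ b → if b then 1 else 0) not-vertical) jump
    where
      not-vertical : isVAt n (suc n) ≡ false
      not-vertical with isVAt n (suc n) in at
      ... | false = refl
      ... | true with isVAt-sound n (suc n) at
      ...   | m , _ , posV≡n = ⊥-elim (ℕ.<-irrefl (trans (sym (vertical⇒step m n posV≡n)) jump) (ℕ.n<1+n _))

  F-binary : ∀ n → F n ≡ 0 ⊎ F n ≡ 1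
  F-binary n with isVAt n (suc n)
  ... | true  = inj₂ refl
  ... | false = inj₁ refl

module Substitution where

  open import Data.Nat using (ℕ; zero; suc; _+_; _*_; _∸_; _≤_; _<_; z≤n; s≤s; _≡ᵇ_)
  import Data.Nat.Properties as ℕ
  import Data.Nat.Tactic.RingSolver as ℕSolver
  open import Data.Bool using (true; false)
  open import Data.List using (List; []; _∷_; _++_; length)
  import Data.List.Properties as List
  open import Data.Product using (∃-syntax; _×_; _,_; proj₁; proj₂)
  open import Data.Sum using (inj₁; inj₂)
  open import Data.Empty using (⊥-elim)
  open import Relation.Nullary using (yes; no)
  open import Relation.Binary.PropositionalEquality
    using (_≡_; refl; sym; trans; cong; cong₂; subst; subst₂; module ≡-Reasoning)
  open import Defs using (Word; F; block; prefixS; nth; SM)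
  open GoldenOrder
  open Floor
  open CuttingSequence

  F≡1⇒step : ∀ n → F n ≡ 1 → ⌊ 2 + n ·φ⌋ ≡ suc ⌊ suc n ·φ⌋
  F≡1⇒step n F≡1 = ℕ.+-cancelˡ-≡ 1 _ _ (subst (λ f → f + ⌊ 2 + n ·φ⌋ ≡ 2 + ⌊ suc n ·φ⌋) F≡1 (F-floor n))

  F≡0⇒jump : ∀ n → F n ≡ 0 → ⌊ 2 + n ·φ⌋ ≡ 2 + ⌊ suc n ·φ⌋
  F≡0⇒jump n F≡0 = subst (λ f → f + ⌊ 2 + n ·φ⌋ ≡ 2 + ⌊ suc n ·φ⌋) F≡0 (F-floor n)

  step⇒F≡1 : ∀ n → ⌊ 2 + n ·φ⌋ ≡ suc ⌊ suc n ·φ⌋ → F n ≡ 1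
  step⇒F≡1 n step = ℕ.+-cancelʳ-≡ ⌊ 2 + n ·φ⌋ (F n) 1 (trans (F-floor n) (cong suc (sym step)))

  jump⇒F≡0 : ∀ n → ⌊ 2 + n ·φ⌋ ≡ 2 + ⌊ suc n ·φ⌋ → F n ≡ 0
  jump⇒F≡0 n jump = ℕ.+-cancelʳ-≡ ⌊ 2 + n ·φ⌋ (F n) 0 (trans (F-floor n) (sym jump))

  F-no-11 : ∀ n → F n ≡ 1 → F (suc n) ≡ 0
  F-no-11 n F≡1 = jump⇒F≡0 (suc n) (trans (⌊⌋-unique below above) (cong (2 +_) (sym (F≡1⇒step n F≡1))))
    where
      K = ⌊ suc n ·φ⌋
      below : 3 + K < 3 + n ·φ
      below = subst₂ _<_·φ (ℕ.+-comm K 3) (ℕ.+-comm (suc n) 2) (<·φ-+ (proj₁ (⌊⌋-bounds n)) 3<2·φ)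
      above : 3 + n ·φ< 4 + K
      above = subst₂ _·φ<_ (ℕ.+-comm (2 + n) 1) (trans (ℕ.+-comm (suc ⌊ 2 + n ·φ⌋) 2) (cong (3 +_) (F≡1⇒step n F≡1)))
                (·φ<-+ (proj₂ (⌊⌋-bounds (suc n))) 1·φ<2)

  -- the number of zeros among F 0 , … , F (n − 1)
  zerosBefore : ℕ → ℕ
  zerosBefore n = ⌊ suc n ·φ⌋ ∸ suc n

  +zerosBefore : ∀ n → suc n + zerosBefore n ≡ ⌊ suc n ·φ⌋
  +zerosBefore n = ℕ.m+[n∸m]≡n (proj₁ (⌊⌋-between n))

  zerosBefore-suc : ∀ n → zerosBefore (suc n) + F n ≡ suc (zerosBefore n)
  zerosBefore-suc n = ℕ.+-cancelˡ-≡ (2 + n) _ _ (begin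
    2 + n + (zerosBefore (suc n) + F n)  ≡⟨ sym (ℕ.+-assoc (2 + n) _ (F n)) ⟩
    2 + n + zerosBefore (suc n) + F n    ≡⟨ cong (_+ F n) (+zerosBefore (suc n)) ⟩
    ⌊ 2 + n ·φ⌋ + F n                    ≡⟨ ℕ.+-comm _ (F n) ⟩
    F n + ⌊ 2 + n ·φ⌋                    ≡⟨ F-floor n ⟩
    2 + ⌊ suc n ·φ⌋                      ≡⟨ cong (2 +_) (sym (+zerosBefore n)) ⟩
    2 + (suc n + zerosBefore n)          ≡⟨ cong suc (sym (ℕ.+-suc (suc n) (zerosBefore n))) ⟩
    2 + n + suc (zerosBefore n)          ∎)
    where open ≡-Reasoning

  module ZeroAt (n : ℕ) (F≡0 : F n ≡ 0) where
    z = zerosBefore n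

    ⌊2+n⌋≡ : ⌊ 2 + n ·φ⌋ ≡ 2 + n + suc z
    ⌊2+n⌋≡ = trans (F≡0⇒jump n F≡0) (trans (cong (2 +_) (sym (+zerosBefore n))) (lemma n z))
      where lemma : ∀ n z → 2 + (suc n + z) ≡ 2 + n + suc z
            lemma = ℕSolver.solve-∀

    below : suc n < suc z ·φ
    below = ·φ<-φ (subst (suc n ·φ<_) (trans (cong suc (sym (+zerosBefore n))) (sym (ℕ.+-suc (suc n) z)))
                 (proj₂ (⌊⌋-bounds n)))

    above : suc z ·φ< 2 + n
    above = <·φ-φ (subst (_< 2 + n ·φ) ⌊2+n⌋≡ (proj₁ (⌊⌋-bounds (suc n))))

    ⌊z+1⌋≡n+1 : ⌊ suc z ·φ⌋ ≡ suc n
    ⌊z+1⌋≡n+1 = ⌊⌋-unique below above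

  -- F is the fixed point of the Fibonacci substitution 0 ↦ 01, 1 ↦ 0: the zero
  -- F n, which is the (zerosBefore n)-th zero, is followed by a 1 exactly when
  -- it is the image of the letter 0.
  F-desubstitute : ∀ n → F n ≡ 0 → F (suc n) + F (zerosBefore n) ≡ 1
  F-desubstitute n F≡0 with F-binary (suc n)
  ... | inj₁ F′≡0 = cong₂ _+_ F′≡0 (step⇒F≡1 z (trans (⌊⌋-unique (<·φ-suc below) above′) (cong suc (sym ⌊z+1⌋≡n+1))))
    where
      open ZeroAt n F≡0
      above′ : 2 + z ·φ< 3 + n
      above′ = <·φ-φ (subst (_< 3 + n ·φ) (trans (F≡0⇒jump (suc n) F′≡0) (trans (cong (2 +_) ⌊2+n⌋≡) (lemma n z)))
                   (proj₁ (⌊⌋-bounds (2 + n))))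
        where lemma : ∀ n z → 2 + (2 + n + suc z) ≡ 3 + n + (2 + z)
              lemma = ℕSolver.solve-∀
  ... | inj₂ F′≡1 = cong₂ _+_ F′≡1 (jump⇒F≡0 z (trans (⌊⌋-unique below′ above′) (cong (2 +_) (sym ⌊z+1⌋≡n+1))))
    where
      open ZeroAt n F≡0
      below′ : 3 + n < 2 + z ·φ
      below′ = ·φ<-φ (subst (3 + n ·φ<_) (trans (cong suc (F≡1⇒step (suc n) F′≡1)) (trans (cong (2 +_) ⌊2+n⌋≡) (lemma n z)))
                   (proj₂ (⌊⌋-bounds (2 + n))))
        where lemma : ∀ n z → 2 + (2 + n + suc z) ≡ 3 + n + (2 + z)
              lemma = ℕSolver.solve-∀
      above′ : 2 + z ·φ< 4 + n
      above′ = subst₂ _·φ<_ (ℕ.+-comm (suc z) 1) (ℕ.+-comm (2 + n) 2) (·φ<-+ above 1·φ<2)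

  zeroInterleaved : Word → Word
  zeroInterleaved f zero          = 0
  zeroInterleaved f (suc zero)    = suc (f 0)
  zeroInterleaved f (suc (suc j)) = zeroInterleaved (λ c → f (suc c)) j

  zeroInterleaved-even : ∀ f c → zeroInterleaved f (2 * c) ≡ 0
  zeroInterleaved-even f zero    = refl
  zeroInterleaved-even f (suc c) rewrite ℕ.+-suc c (c + 0) = zeroInterleaved-even (λ x → f (suc x)) c

  zeroInterleaved-odd : ∀ f c → zeroInterleaved f (suc (2 * c)) ≡ suc (f c)
  zeroInterleaved-odd f zero    = refl
  zeroInterleaved-odd f (suc c) rewrite ℕ.+-suc c (c + 0) = zeroInterleaved-odd (λ x → f (suc x)) c

  SM′ : Word
  SM′ = zeroInterleaved F

  ≡ᵇ0-≡ : ∀ {a b c} → a ≡ b → (a ≡ᵇ 0) ≡ c → (b ≡ᵇ 0) ≡ c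
  ≡ᵇ0-≡ refl eq = eq

  block-1 : ∀ i → F i ≡ 1 → block i ≡ 1 ∷ []
  block-1 i F≡1 with F i ≡ᵇ 0 in isZero | F (suc i) ≡ᵇ 0
  ... | true  | true  with ≡ᵇ0-≡ F≡1 isZero
  ...   | ()
  block-1 i F≡1 | true  | false = cong (_∷ []) F≡1
  block-1 i F≡1 | false | _     = cong (_∷ []) F≡1

  block-01 : ∀ i → F i ≡ 0 → F (suc i) ≡ 1 → block i ≡ 0 ∷ []
  block-01 i F≡0 F′≡1 with F i ≡ᵇ 0 | F (suc i) ≡ᵇ 0 in isZero
  ... | true  | true  with ≡ᵇ0-≡ F′≡1 isZero
  ...   | ()
  block-01 i F≡0 F′≡1 | true  | false = cong (_∷ []) F≡0
  block-01 i F≡0 F′≡1 | false | _     = cong (_∷ []) F≡0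

  block-00 : ∀ i → F i ≡ 0 → F (suc i) ≡ 0 → block i ≡ 0 ∷ 2 ∷ []
  block-00 i F≡0 F′≡0 with F i ≡ᵇ 0 in isZero | F (suc i) ≡ᵇ 0 in isZero′
  ... | true  | true  = refl
  ... | true  | false with ≡ᵇ0-≡ F′≡0 isZero′
  ...   | ()
  block-00 i F≡0 F′≡0 | false | _ with ≡ᵇ0-≡ F≡0 isZero
  ...   | ()

  block-length : ∀ n → length (block n) + F (suc n) + F n ≡ 2
  block-length n with F-binary n
  ... | inj₂ F≡1 = cong₂ _+_ (cong₂ _+_ (cong length (block-1 n F≡1)) (F-no-11 n F≡1)) F≡1
  ... | inj₁ F≡0 with F-binary (suc n)
  ...   | inj₁ F′≡0 = cong₂ _+_ (cong₂ _+_ (cong length (block-00 n F≡0 F′≡0)) F′≡0) F≡0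
  ...   | inj₂ F′≡1 = cong₂ _+_ (cong₂ _+_ (cong length (block-01 n F≡0 F′≡1)) F′≡1) F≡0

  prefixS-length : ∀ n → length (prefixS n) + F n ≡ 2 * zerosBefore n
  prefixS-length zero    = cong (λ x → 2 * (x ∸ 1)) (sym ⌊1·φ⌋≡1)
  prefixS-length (suc n) = ℕ.+-cancelʳ-≡ (2 * F n) _ _ (begin
    length (prefixS n ++ block n) + F (suc n) + 2 * F n
      ≡⟨ cong (λ l → l + F (suc n) + 2 * F n) (List.length-++ (prefixS n)) ⟩
    L + length (block n) + F (suc n) + 2 * F n
      ≡⟨ lemma L (length (block n)) (F n) (F (suc n)) ⟩
    (L + F n) + (length (block n) + F (suc n) + F n)
      ≡⟨ cong₂ _+_ (prefixS-length n) (block-length n) ⟩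
    2 * zerosBefore n + 2
      ≡⟨ lemma′ (zerosBefore n) ⟩
    2 * suc (zerosBefore n)
      ≡⟨ cong (2 *_) (sym (zerosBefore-suc n)) ⟩
    2 * (zerosBefore (suc n) + F n)
      ≡⟨ ℕ.*-distribˡ-+ 2 (zerosBefore (suc n)) (F n) ⟩
    2 * zerosBefore (suc n) + 2 * F n ∎)
    where
      open ≡-Reasoning
      L = length (prefixS n)
      lemma : ∀ L b f f′ → L + b + f′ + 2 * f ≡ (L + f) + (b + f′ + f)
      lemma = ℕSolver.solve-∀
      lemma′ : ∀ z → 2 * z + 2 ≡ 2 * suc z
      lemma′ = ℕSolver.solve-∀

  F≡1⇒preceded-by-0 : ∀ n → F n ≡ 1 → ∃[ m ] n ≡ suc m × F m ≡ 0
  F≡1⇒preceded-by-0 zero    ()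
  F≡1⇒preceded-by-0 (suc m) F≡1 with F-binary m
  ... | inj₁ F≡0  = m , refl , F≡0
  ... | inj₂ F′≡1 = ⊥-elim (ℕ.0≢1+n (trans (sym (F-no-11 m F′≡1)) F≡1))

  nth-++ˡ : ∀ xs ys t → t < length xs → nth (xs ++ ys) t ≡ nth xs t
  nth-++ˡ (x ∷ xs) ys zero    _   = refl
  nth-++ˡ (x ∷ xs) ys (suc t) t<n = nth-++ˡ xs ys t (ℕ.≤-pred t<n)

  nth-++ʳ : ∀ xs ys t → nth (xs ++ ys) (length xs + t) ≡ nth ys t
  nth-++ʳ []       ys t = refl
  nth-++ʳ (x ∷ xs) ys t = nth-++ʳ xs ys t

  Agrees : List ℕ → ℕ → Set
  Agrees xs offset = ∀ t → t < length xs → nth xs t ≡ SM′ (offset + t)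

  Agrees-++ : ∀ xs ys → Agrees xs 0 → Agrees ys (length xs) → Agrees (xs ++ ys) 0
  Agrees-++ xs ys agree-xs agree-ys t t<len with t ℕ.<? length xs
  ... | yes t<xs = trans (nth-++ˡ xs ys t t<xs) (agree-xs t t<xs)
  ... | no  t≮xs = subst (λ t → nth (xs ++ ys) t ≡ SM′ t) xs+s≡t
                     (trans (nth-++ʳ xs ys s) (agree-ys s s<ys))
    where
      s = t ∸ length xs
      xs+s≡t : length xs + s ≡ t
      xs+s≡t = ℕ.m+[n∸m]≡n (ℕ.≮⇒≥ t≮xs)
      s<ys : s < length ys
      s<ys = ℕ.+-cancelˡ-< (length xs) s (length ys)
               (subst₂ _<_ (sym xs+s≡t) (List.length-++ xs) t<len)

  Agrees-singleton : ∀ a offset → a ≡ SM′ offset → Agrees (a ∷ []) offset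
  Agrees-singleton a offset a≡ zero    _ = trans a≡ (cong SM′ (sym (ℕ.+-identityʳ offset)))
  Agrees-singleton a offset a≡ (suc t) (s≤s ())

  Agrees-pair : ∀ a b offset → a ≡ SM′ offset → b ≡ SM′ (suc offset) → Agrees (a ∷ b ∷ []) offset
  Agrees-pair a b offset a≡ b≡ zero          _ = trans a≡ (cong SM′ (sym (ℕ.+-identityʳ offset)))
  Agrees-pair a b offset a≡ b≡ (suc zero)    _ = trans b≡ (cong SM′ (trans (ℕ.+-comm 1 offset) refl))
  Agrees-pair a b offset a≡ b≡ (suc (suc t)) (s≤s (s≤s ()))

  block-agrees : ∀ n → Agrees (block n) (length (prefixS n))
  block-agrees n with F-binary n
  ... | inj₂ F≡1 with F≡1⇒preceded-by-0 n F≡1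
  ...   | m , refl , F≡0 = subst (λ b → Agrees b L) (sym (block-1 n F≡1))
                             (Agrees-singleton 1 L (sym (trans (cong SM′ L≡) (trans (zeroInterleaved-odd F z) (cong suc Fz≡0)))))
    where
      L = length (prefixS n)
      z = zerosBefore m
      Fz≡0 : F z ≡ 0
      Fz≡0 = ℕ.+-cancelˡ-≡ 1 (F z) 0 (subst (λ f → f + F z ≡ 1) F≡1 (F-desubstitute m F≡0))
      L≡ : L ≡ suc (2 * z)
      L≡ = ℕ.+-cancelʳ-≡ 1 L (suc (2 * z)) (trans (cong (L +_) (sym F≡1)) (trans (prefixS-length n)
             (trans (cong (2 *_) Zn≡) (lemma z))))
        where
          Zn≡ : zerosBefore n ≡ suc z
          Zn≡ = trans (sym (ℕ.+-identityʳ (zerosBefore n)))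
                  (trans (cong (zerosBefore n +_) (sym F≡0)) (zerosBefore-suc m))
          lemma : ∀ z → 2 * suc z ≡ suc (2 * z) + 1
          lemma = ℕSolver.solve-∀
  block-agrees n | inj₁ F≡0 with F-binary (suc n)
  ... | inj₂ F′≡1 = subst (λ b → Agrees b L) (sym (block-01 n F≡0 F′≡1)) (Agrees-singleton 0 L (sym SM′L≡0))
    where
      L = length (prefixS n)
      SM′L≡0 : SM′ L ≡ 0
      SM′L≡0 = trans (cong SM′ (trans (sym (ℕ.+-identityʳ L)) (trans (cong (L +_) (sym F≡0)) (prefixS-length n))))
                 (zeroInterleaved-even F (zerosBefore n))
  ... | inj₁ F′≡0 = subst (λ b → Agrees b L) (sym (block-00 n F≡0 F′≡0)) (Agrees-pair 0 2 L (sym SM′L≡0) (sym SM′L+1≡2))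
    where
      L = length (prefixS n)
      L≡ : L ≡ 2 * zerosBefore n
      L≡ = trans (sym (ℕ.+-identityʳ L)) (trans (cong (L +_) (sym F≡0)) (prefixS-length n))
      SM′L≡0 : SM′ L ≡ 0
      SM′L≡0 = trans (cong SM′ L≡) (zeroInterleaved-even F (zerosBefore n))
      SM′L+1≡2 : SM′ (suc L) ≡ 2
      SM′L+1≡2 = trans (cong (λ l → SM′ (suc l)) L≡) (trans (zeroInterleaved-odd F (zerosBefore n))
                   (cong suc (subst (λ f → f + F (zerosBefore n) ≡ 1) F′≡0 (F-desubstitute n F≡0))))

  prefixS-agrees : ∀ n → Agrees (prefixS n) 0
  prefixS-agrees zero    t ()
  prefixS-agrees (suc n) = Agrees-++ (prefixS n) (block n) (prefixS-agrees n) (block-agrees n)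

  1≤length-block : ∀ i → 1 ≤ length (block i)
  1≤length-block i with F i ≡ᵇ 0 | F (suc i) ≡ᵇ 0
  ... | true  | true  = s≤s z≤n
  ... | true  | false = s≤s z≤n
  ... | false | _     = s≤s z≤n

  n≤length-prefixS : ∀ n → n ≤ length (prefixS n)
  n≤length-prefixS zero    = z≤n
  n≤length-prefixS (suc n) = subst (suc n ≤_) (sym (List.length-++ (prefixS n)))
    (subst (_≤ length (prefixS n) + length (block n)) (ℕ.+-comm n 1)
      (ℕ.+-mono-≤ (n≤length-prefixS n) (1≤length-block n)))

  SM≡SM′ : ∀ j → SM j ≡ SM′ j
  SM≡SM′ j = prefixS-agrees (suc j) j (n≤length-prefixS (suc j))

module Fibonacci where

  open import Data.Nat as ℕ using (ℕ; zero; suc; z≤n; s≤s)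
  import Data.Nat.Properties as ℕ
  open import Data.Integer
    using (ℤ; +_; 0ℤ; 1ℤ; _+_; _-_; _*_; -_; _<_; _≤_; +<+; +≤+)
  import Data.Integer.Properties as ℤ
  open import Data.Integer.Tactic.RingSolver using (solve-∀)
  open import Data.Product using (_×_; _,_; proj₁; proj₂)
  open import Data.Sum using (_⊎_; inj₁; inj₂)
  open import Data.Empty using (⊥; ⊥-elim)
  open import Relation.Binary.PropositionalEquality
    using (_≡_; refl; sym; trans; cong; cong₂; subst; subst₂; module ≡-Reasoning)
  open GoldenInteger
  open GoldenOrder
  open Floor

  fib : ℕ → ℕ
  fib zero          = 0
  fib (suc zero)    = 1
  fib (suc (suc n)) = fib (suc n) ℕ.+ fib n

  +fib : ∀ n → + fib (suc (suc n)) ≡ + fib (suc n) + + fib n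
  +fib n = ℤ.pos-+ (fib (suc n)) (fib n)

  sgn : ℕ → ℤ
  sgn zero    = 1ℤ
  sgn (suc n) = - sgn n

  sgn*sgn : ∀ n → sgn n * sgn n ≡ 1ℤ
  sgn*sgn zero    = refl
  sgn*sgn (suc n) = trans (lemma (sgn n)) (sgn*sgn n)
    where lemma : ∀ s → - s * - s ≡ s * s
          lemma = solve-∀

  sgn-cases : ∀ n → sgn n ≡ 1ℤ ⊎ sgn n ≡ - 1ℤ
  sgn-cases zero    = inj₁ refl
  sgn-cases (suc n) with sgn-cases n
  ... | inj₁ s≡1  = inj₂ (cong -_ s≡1)
  ... | inj₂ s≡-1 = inj₁ (cong -_ s≡-1)

  cassini : ∀ n → + fib (suc n) * + fib (suc n) - + fib n * + fib (suc (suc n)) ≡ sgn n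
  cassini zero    = refl
  cassini (suc n) = begin
    + fib (suc (suc n)) * + fib (suc (suc n)) - + fib (suc n) * + fib (suc (suc (suc n)))
      ≡⟨ cong₂ (λ x y → x * x - b * y) (+fib n) (trans (+fib (suc n)) (cong (_+ b) (+fib n))) ⟩
    (b + a) * (b + a) - b * (b + a + b)
      ≡⟨ lemma a b ⟩
    - (b * b - a * (b + a))
      ≡⟨ cong (λ x → - (b * b - a * x)) (sym (+fib n)) ⟩
    - (b * b - a * + fib (suc (suc n)))
      ≡⟨ cong -_ (cassini n) ⟩
    - sgn n ∎
    where
      open ≡-Reasoning
      a = + fib n
      b = + fib (suc n)
      lemma : ∀ a b → (b + a) * (b + a) - b * (b + a + b) ≡ - (b * b - a * (b + a))
      lemma = solve-∀

  δ : ℕ → ℤ[φ]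
  δ n = - + fib (suc n) , + fib n

  -- |fib (n + 1) · φ − fib (n + 2)| = φ^−(n + 1)
  error : ℕ → ℤ[φ]
  error n = sgn n · δ (suc n)

  error-suc : ∀ n → error (suc n) ≡ φ⁻¹· error n
  error-suc n = cong₂ _,_
    (trans (cong (λ x → - sgn n * - x) (+fib (suc n))) (lemma (sgn n) (+ fib (suc (suc n))) (+ fib (suc n))))
    (lemma′ (sgn n) (+ fib (suc (suc n))))
    where
      lemma : ∀ s c b → - s * - (c + b) ≡ s * b - s * - c
      lemma = solve-∀
      lemma′ : ∀ s c → - s * c ≡ s * - c
      lemma′ = solve-∀

  Pos-error : ∀ n → Pos (error n)
  Pos-error zero    = 1<1·φ
  Pos-error (suc n) = subst Pos (sym (error-suc n)) (Pos-φ⁻¹· (Pos-error n))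

  1-φ⁻¹· : ∀ x → (1ℤ , 0ℤ) ⊕ ⊝ x ⊕ φ⁻¹· φ⁻¹· x ≡ (1ℤ , 0ℤ) ⊕ ⊝ φ⁻¹· x
  1-φ⁻¹· (a , b) = cong₂ _,_ (lemma a b) (lemma′ a b)
    where
      lemma : ∀ a b → 1ℤ + - a + (a - (b - a)) ≡ 1ℤ + - (b - a)
      lemma = solve-∀
      lemma′ : ∀ a b → 0ℤ + - b + (b - a) ≡ 0ℤ + - a
      lemma′ = solve-∀

  error<1 : ∀ n → Pos ((1ℤ , 0ℤ) ⊕ ⊝ error n)
  error<1 zero    = 1·φ<2
  error<1 (suc n) = subst Pos (trans (1-φ⁻¹· (error n)) (cong (λ e → (1ℤ , 0ℤ) ⊕ ⊝ e) (sym (error-suc n))))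
    (Pos-⊕ (error<1 n) (Pos-φ⁻¹· (Pos-φ⁻¹· (Pos-error n))))

  Pos-previous-error : ∀ n → Pos (sgn n · ⊝ δ n)
  Pos-previous-error zero    = 0 , +≤+ z≤n , +≤+ z≤n , +<+ (s≤s z≤n)
  Pos-previous-error (suc n) = Pos-≡ (lemma (sgn n) _) (lemma (sgn n) _) (Pos-error n)
    where lemma : ∀ s x → s * x ≡ - s * - x
          lemma = solve-∀

  0<⇒0≤-1 : ∀ {u} → 0ℤ < u → 0ℤ ≤ u - 1ℤ
  0<⇒0≤-1 {+ suc n} _ = subst (0ℤ ≤_) (sym (lemma (+ n))) (+≤+ z≤n)
    where lemma : ∀ n → 1ℤ + n - 1ℤ ≡ n
          lemma = solve-∀
  0<⇒0≤-1 {+ zero} (+<+ ())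

  -- Cassini's identity lets us write s = u fib (n + 1) + v fib n and
  -- t = u fib (n + 2) + v fib (n + 1), that is s φ − t = u δ (n + 1) + v δ n.
  module Coordinates (n s : ℕ) (t : ℤ) where
    σ = sgn n
    M = + fib (suc n)
    m = + fib n
    N = + fib (suc (suc n))
    S = + s
    u = σ * (S * M - t * m)
    v = σ * (t * M - S * N)

    unit : ∀ x → σ * x * σ ≡ x
    unit x = trans (lemma σ x) (trans (cong (x *_) (sgn*sgn n)) (ℤ.*-identityʳ x))
      where lemma : ∀ σ x → σ * x * σ ≡ x * (σ * σ)
            lemma = solve-∀

    s≡ : u * M + v * m ≡ S
    s≡ = trans (lemma σ S t M m N) (trans (cong (σ * S *_) (cassini n)) (unit S))
      where lemma : ∀ σ S t M m N → σ * (S * M - t * m) * M + σ * (t * M - S * N) * m ≡ σ * S * (M * M - m * N)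
            lemma = solve-∀

    t≡ : u * N + v * M ≡ t
    t≡ = trans (lemma σ S t M m N) (trans (cong (σ * t *_) (cassini n)) (unit t))
      where lemma : ∀ σ S t M m N → σ * (S * M - t * m) * N + σ * (t * M - S * N) * M ≡ σ * t * (M * M - m * N)
            lemma = solve-∀

    -- No 0 < s < fib (n + 1) brings s φ closer to an integer, on the side of
    -- the sign of error n, than fib (n + 1) φ is to fib (n + 2).
    no-closer : 0 ℕ.< s → s ℕ.< fib (suc n) → Pos (σ · (- t , S)) → Pos (error n ⊕ ⊝ (σ · (- t , S))) → ⊥
    no-closer 0<s s<M x>0 error>x with 0<⊎0≤- u
    ... | inj₁ 0<u with 0<⊎0≤- (- v)
    ...   | inj₁ 0<-v = Pos-asym error>x (Pos-≡ first second
                          (Pos-⊕-· (0<⇒0≤-1 0<u) (Pos-error n) (Pos-· (- v) 0<-v (Pos-previous-error n))))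
      where
        first : - v * (σ * - - M) + (u - 1ℤ) * (σ * - N) ≡ - (σ * - N + - (σ * - t))
        first = trans (lemma σ u v M N) (trans (cong (λ z → σ * N - σ * z) t≡) (lemma′ σ N t))
          where lemma : ∀ σ u v M N → - v * (σ * - - M) + (u - 1ℤ) * (σ * - N) ≡ σ * N - σ * (u * N + v * M)
                lemma = solve-∀
                lemma′ : ∀ σ N t → σ * N - σ * t ≡ - (σ * - N + - (σ * - t))
                lemma′ = solve-∀
        second : - v * (σ * - m) + (u - 1ℤ) * (σ * M) ≡ - (σ * M + - (σ * S))
        second = trans (lemma σ u v M m) (trans (cong (λ z → σ * z - σ * M) s≡) (lemma′ σ M S))
          where lemma : ∀ σ u v M m → - v * (σ * - m) + (u - 1ℤ) * (σ * M) ≡ σ * (u * M + v * m) - σ * M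
                lemma = solve-∀
                lemma′ : ∀ σ M S → σ * S - σ * M ≡ - (σ * M + - (σ * S))
                lemma′ = solve-∀
    ...   | inj₂ 0≤--v = ℤ.<-irrefl refl (ℤ.≤-<-trans M≤S (+<+ s<M))
      where
        0≤v = subst (0ℤ ≤_) (ℤ.neg-involutive v) 0≤--v
        M≤S : M ≤ S
        M≤S = ℤ.0≤i-j⇒j≤i (subst (0ℤ ≤_) (trans (lemma u v M m) (cong (_- M) s≡))
                (ℤ.+-mono-≤ (0≤-* (0<⇒0≤-1 0<u) (+≤+ z≤n)) (0≤-* 0≤v (+≤+ z≤n))))
          where lemma : ∀ u v M m → (u - 1ℤ) * M + v * m ≡ u * M + v * m - M
                lemma = solve-∀
    no-closer 0<s s<M x>0 error>x | inj₂ 0≤-u with 0<⊎0≤- v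
    ... | inj₁ 0<v = Pos-asym x>0 (Pos-≡ first second
                       (Pos-⊕-· 0≤-u (Pos-error n) (Pos-· v 0<v (Pos-previous-error n))))
      where
        first : v * (σ * - - M) + - u * (σ * - N) ≡ - (σ * - t)
        first = trans (lemma σ u v M N) (trans (cong (σ *_) t≡) (lemma′ σ t))
          where lemma : ∀ σ u v M N → v * (σ * - - M) + - u * (σ * - N) ≡ σ * (u * N + v * M)
                lemma = solve-∀
                lemma′ : ∀ σ t → σ * t ≡ - (σ * - t)
                lemma′ = solve-∀
        second : v * (σ * - m) + - u * (σ * M) ≡ - (σ * S)
        second = trans (lemma σ u v M m) (cong (λ z → - (σ * z)) s≡)
          where lemma : ∀ σ u v M m → v * (σ * - m) + - u * (σ * M) ≡ - (σ * (u * M + v * m))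
                lemma = solve-∀
    ... | inj₂ 0≤-v = 0≤-neg-asym 0≤-S (subst (0ℤ <_) (sym (ℤ.neg-involutive S)) (+<+ 0<s))
      where
        0≤-S : 0ℤ ≤ - S
        0≤-S = subst (0ℤ ≤_) (trans (lemma u v M m) (cong -_ s≡)) (ℤ.+-mono-≤ (0≤-* 0≤-u (+≤+ z≤n)) (0≤-* 0≤-v (+≤+ z≤n)))
          where lemma : ∀ u v M m → - u * M + - v * m ≡ - (u * M + v * m)
                lemma = solve-∀

  best-approximation : ∀ n s t → 0 ℕ.< s → s ℕ.< fib (suc n) →
                       Pos (sgn n · (- t , + s)) → Pos (error n ⊕ ⊝ (sgn n · (- t , + s))) → ⊥
  best-approximation n s t = Coordinates.no-closer n s t

  1≤fib : ∀ n → 1 ℕ.≤ fib (suc n)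
  1≤fib zero    = s≤s z≤n
  1≤fib (suc n) = ℕ.≤-trans (1≤fib n) (ℕ.m≤m+n _ _)

  bounds-even : ∀ {σ M N} → σ ≡ 1ℤ → Pos (σ · (- + N , + M)) → Pos ((1ℤ , 0ℤ) ⊕ ⊝ (σ · (- + N , + M))) →
                N < M ·φ × M ·φ< suc N
  bounds-even {M = M} {N} refl e>0 e<1 =
    Pos-≡ (ℤ.*-identityˡ _) (ℤ.*-identityˡ _) e>0 ,
    Pos-≡ (lemma (+ N)) (lemma′ (+ M)) e<1
    where lemma : ∀ x → 1ℤ + - (1ℤ * - x) ≡ 1ℤ + x
          lemma = solve-∀
          lemma′ : ∀ x → 0ℤ + - (1ℤ * x) ≡ - x
          lemma′ = solve-∀

  bounds-odd : ∀ {σ M N} → 1 ℕ.≤ N → σ ≡ - 1ℤ → Pos (σ · (- + N , + M)) →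
               Pos ((1ℤ , 0ℤ) ⊕ ⊝ (σ · (- + N , + M))) → M ·φ< N × ℕ.pred N < M ·φ
  bounds-odd {M = M} {suc N′} _ refl e>0 e<1 =
    Pos-≡ (lemma (+ suc N′)) (ℤ.-1*i≡-i _) e>0 ,
    Pos-≡ (lemma′ (+ N′)) (lemma″ (+ M)) e<1
    where lemma : ∀ x → - 1ℤ * - x ≡ x
          lemma = solve-∀
          lemma′ : ∀ x → 1ℤ + - (- 1ℤ * - (1ℤ + x)) ≡ - x
          lemma′ = solve-∀
          lemma″ : ∀ x → 0ℤ + - (- 1ℤ * x) ≡ x
          lemma″ = solve-∀

  Pos-1· : ∀ {σ x} → σ ≡ 1ℤ → Pos x → Pos (σ · x)
  Pos-1· {x = a , b} refl p = Pos-≡ (sym (ℤ.*-identityˡ a)) (sym (ℤ.*-identityˡ b)) p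

  Pos--1· : ∀ {σ x} → σ ≡ - 1ℤ → Pos (⊝ x) → Pos (σ · x)
  Pos--1· {x = a , b} refl p = Pos-≡ (sym (ℤ.-1*i≡-i a)) (sym (ℤ.-1*i≡-i b)) p

  Pos-split : ∀ σ {a b s s′} → Pos (σ · (- + b , + s′)) →
              Pos (σ · (- + (a ℕ.+ b) , + (s ℕ.+ s′)) ⊕ ⊝ (σ · (- + a , + s)))
  Pos-split σ {a} {b} {s} {s′} p = Pos-≡
    (trans (lemma σ (+ a) (+ b)) (cong (λ z → σ * - z + - (σ * - + a)) (sym (ℤ.pos-+ a b))))
    (trans (lemma′ σ (+ s) (+ s′)) (cong (λ z → σ * z + - (σ * + s)) (sym (ℤ.pos-+ s s′)))) p
    where lemma : ∀ σ a b → σ * - b ≡ σ * - (a + b) + - (σ * - a)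
          lemma = solve-∀
          lemma′ : ∀ σ s s′ → σ * s′ ≡ σ * (s + s′) + - (σ * s)
          lemma′ = solve-∀

  module Reflection (n s s′ : ℕ) (M≡ : suc s ℕ.+ suc s′ ≡ fib (suc n)) where
    a = ⌊ suc s ·φ⌋
    b = ⌊ suc s′ ·φ⌋
    M = fib (suc n)
    N = fib (suc (suc n))

    a+b<Mφ : a ℕ.+ b < M ·φ
    a+b<Mφ = subst (a ℕ.+ b <_·φ) M≡ (proj₁ (⌊⌋-+-bounds s s′))

    Mφ<a+b+2 : M ·φ< suc a ℕ.+ suc b
    Mφ<a+b+2 = subst (_·φ< suc a ℕ.+ suc b) M≡ (proj₂ (⌊⌋-+-bounds s s′))

    closer : ∀ t → Pos (sgn n · (- t , + suc s)) → Pos (error n ⊕ ⊝ (sgn n · (- t , + suc s))) → ⊥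
    closer t = best-approximation n (suc s) t (s≤s z≤n) (subst (suc s ℕ.<_) M≡ (ℕ.m<m+n (suc s) (s≤s z≤n)))

    reflection : a ℕ.+ b ℕ.+ 1 ≡ N
    reflection with sgn-cases n
    ... | inj₁ σ≡1 with bounds-even σ≡1 (Pos-error n) (error<1 n)
    ...   | N<Mφ , Mφ<N+1 with ℕ.m≤n⇒m<n∨m≡n (ℕ.≤-pred (<·φ-·φ<⇒< a+b<Mφ Mφ<N+1))
    ...     | inj₁ a+b<N = trans (ℕ.+-comm (a ℕ.+ b) 1) (ℕ.≤-antisym a+b<N N≤a+b+1)
      where
        N≤a+b+1 : N ℕ.≤ suc (a ℕ.+ b)
        N≤a+b+1 = subst (N ℕ.≤_) (ℕ.+-suc a b) (ℕ.≤-pred (<·φ-·φ<⇒< N<Mφ Mφ<a+b+2))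
    ...     | inj₂ a+b≡N = ⊥-elim (closer (+ a) (Pos-1· σ≡1 (proj₁ (⌊⌋-bounds s)))
                             (subst₂ (λ N M → Pos (sgn n · (- + N , + M) ⊕ ⊝ (sgn n · (- + a , + suc s)))) a+b≡N M≡
                               (Pos-split (sgn n) (Pos-1· σ≡1 (proj₁ (⌊⌋-bounds s′))))))
    reflection | inj₂ σ≡-1 with bounds-odd (1≤fib (suc n)) σ≡-1 (Pos-error n) (error<1 n)
    ... | Mφ<N , N-1<Mφ with ℕ.m≤n⇒m<n∨m≡n (<·φ-·φ<⇒< a+b<Mφ Mφ<N)
    ...   | inj₂ a+b+1≡N = trans (ℕ.+-comm (a ℕ.+ b) 1) a+b+1≡N
    ...   | inj₁ a+b+1<N = ⊥-elim (closer (+ suc a) (Pos--1· σ≡-1 (Pos-≡ (sym (ℤ.neg-involutive _)) refl (proj₂ (⌊⌋-bounds s))))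
                             (subst₂ (λ N M → Pos (sgn n · (- + N , + M) ⊕ ⊝ (sgn n · (- + suc a , + suc s)))) a+b+2≡N M≡
                               (Pos-split (sgn n) (Pos--1· σ≡-1 (Pos-≡ (sym (ℤ.neg-involutive _)) refl (proj₂ (⌊⌋-bounds s′)))))))
      where
        a+b+2≡N : suc a ℕ.+ suc b ≡ N
        a+b+2≡N = ℕ.≤-antisym (subst (ℕ._≤ N) (cong suc (sym (ℕ.+-suc a b))) a+b+1<N)
                    (subst (ℕ._≤ suc a ℕ.+ suc b) (ℕ.suc-pred N {{ℕ.>-nonZero (1≤fib (suc n))}})
                      (<·φ-·φ<⇒< N-1<Mφ Mφ<a+b+2))

  -- If s + s′ = fib (n + 1) with s , s′ ≥ 1, the fractional parts of s φ and
  -- s′ φ add up to 1 + (fib (n + 1) φ − fib (n + 2)); a smaller or larger sum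
  -- would contradict the best approximation property.
  ⌊⌋-reflection : ∀ n s s′ → suc s ℕ.+ suc s′ ≡ fib (suc n) →
                  ⌊ suc s ·φ⌋ ℕ.+ ⌊ suc s′ ·φ⌋ ℕ.+ 1 ≡ fib (suc (suc n))
  ⌊⌋-reflection n s s′ M≡ = Reflection.reflection n s s′ M≡

module Palindromes where

  open import Data.Nat using (ℕ; zero; suc; _+_; _*_; _≤_; _<_; z≤n; s≤s)
  import Data.Nat.Properties as ℕ
  import Data.Nat.Tactic.RingSolver as ℕSolver
  open import Data.Product using (∃-syntax; _×_; _,_; proj₁; proj₂)
  open import Data.Sum using (_⊎_; inj₁; inj₂)
  open import Data.Empty using (⊥; ⊥-elim)
  open import Relation.Binary.PropositionalEquality
    using (_≡_; refl; sym; trans; cong; cong₂; subst; subst₂; module ≡-Reasoning)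
  open import Defs using (Word; F)
  open Floor
  open CuttingSequence
  open Fibonacci using (fib; 1≤fib; ⌊⌋-reflection)
  open Substitution using (SM′; zeroInterleaved-even; zeroInterleaved-odd)

  Mirror : Word → ℕ → ℕ → Set
  Mirror x i n = ∀ t u → t + u + 1 ≡ n → x (i + t) ≡ x (i + u)

  F-mirror : ∀ n x y → x + y + 3 ≡ fib (suc n) → F x ≡ F y
  F-mirror n x y x+y+3≡M = ℕ.+-cancelʳ-≡ (⌊ 2 + x ·φ⌋ + ⌊ 2 + y ·φ⌋) (F x) (F y) (trans (side x y r₁) (sym (trans (cong (F y +_) (ℕ.+-comm ⌊ 2 + x ·φ⌋ ⌊ 2 + y ·φ⌋)) (side y x r₂))))
    where
      r₁ : ⌊ suc x ·φ⌋ + ⌊ 2 + y ·φ⌋ + 1 ≡ fib (suc (suc n))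
      r₁ = ⌊⌋-reflection n x (suc y) (trans (lemma x y) x+y+3≡M)
        where lemma : ∀ x y → suc x + suc (suc y) ≡ x + y + 3
              lemma = ℕSolver.solve-∀
      r₂ : ⌊ suc y ·φ⌋ + ⌊ 2 + x ·φ⌋ + 1 ≡ fib (suc (suc n))
      r₂ = ⌊⌋-reflection n y (suc x) (trans (lemma x y) x+y+3≡M)
        where lemma : ∀ x y → suc y + suc (suc x) ≡ x + y + 3
              lemma = ℕSolver.solve-∀
      side : ∀ x y → ⌊ suc x ·φ⌋ + ⌊ 2 + y ·φ⌋ + 1 ≡ fib (suc (suc n)) →
             F x + (⌊ 2 + x ·φ⌋ + ⌊ 2 + y ·φ⌋) ≡ suc (fib (suc (suc n)))
      side x y r = begin
        F x + (⌊ 2 + x ·φ⌋ + ⌊ 2 + y ·φ⌋) ≡⟨ sym (ℕ.+-assoc (F x) _ _) ⟩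
        F x + ⌊ 2 + x ·φ⌋ + ⌊ 2 + y ·φ⌋   ≡⟨ cong (_+ ⌊ 2 + y ·φ⌋) (F-floor x) ⟩
        2 + ⌊ suc x ·φ⌋ + ⌊ 2 + y ·φ⌋     ≡⟨ cong suc (ℕ.+-comm 1 _) ⟩
        suc (⌊ suc x ·φ⌋ + ⌊ 2 + y ·φ⌋ + 1) ≡⟨ cong suc r ⟩
        suc (fib (suc (suc n)))            ∎
        where open ≡-Reasoning

  ones : ℕ → ℕ → ℕ
  ones a zero    = 0
  ones a (suc L) = F a + ones (suc a) L

  ones-floor : ∀ a L → ones a L + ⌊ suc (a + L) ·φ⌋ ≡ 2 * L + ⌊ suc a ·φ⌋
  ones-floor a zero    = cong (λ z → ⌊ suc z ·φ⌋) (ℕ.+-identityʳ a)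
  ones-floor a (suc L) = begin
    F a + ones (suc a) L + ⌊ suc (a + suc L) ·φ⌋     ≡⟨ cong (λ z → F a + ones (suc a) L + ⌊ suc z ·φ⌋) (ℕ.+-suc a L) ⟩
    F a + ones (suc a) L + ⌊ suc (suc a + L) ·φ⌋     ≡⟨ ℕ.+-assoc (F a) _ _ ⟩
    F a + (ones (suc a) L + ⌊ suc (suc a + L) ·φ⌋)   ≡⟨ cong (F a +_) (ones-floor (suc a) L) ⟩
    F a + (2 * L + ⌊ 2 + a ·φ⌋)                      ≡⟨ lemma (F a) (2 * L) ⌊ 2 + a ·φ⌋ ⟩
    F a + ⌊ 2 + a ·φ⌋ + 2 * L                        ≡⟨ cong (_+ 2 * L) (F-floor a) ⟩
    2 + ⌊ suc a ·φ⌋ + 2 * L                          ≡⟨ lemma′ ⌊ suc a ·φ⌋ L ⟩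
    2 * suc L + ⌊ suc a ·φ⌋                          ∎
    where
      open ≡-Reasoning
      lemma : ∀ f A B → f + (A + B) ≡ f + B + A
      lemma = ℕSolver.solve-∀
      lemma′ : ∀ H L → 2 + H + 2 * L ≡ 2 * suc L + H
      lemma′ = ℕSolver.solve-∀

  ones+⌊⌋-bounds : ∀ a L → ones a (suc L) + ⌊ suc L ·φ⌋ ≤ 2 * suc L × 2 * suc L ≤ suc (ones a (suc L) + ⌊ suc L ·φ⌋)
  ones+⌊⌋-bounds a L =
    ℕ.+-cancelʳ-≤ ⌊ suc a ·φ⌋ _ _ (begin
      ones a (suc L) + ⌊ suc L ·φ⌋ + ⌊ suc a ·φ⌋   ≡⟨ lemma (ones a (suc L)) ⌊ suc L ·φ⌋ ⌊ suc a ·φ⌋ ⟩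
      ones a (suc L) + (⌊ suc a ·φ⌋ + ⌊ suc L ·φ⌋) ≤⟨ ℕ.+-monoʳ-≤ (ones a (suc L)) (proj₁ (⌊⌋-+ a L)) ⟩
      ones a (suc L) + ⌊ suc (a + suc L) ·φ⌋       ≡⟨ ones-floor a (suc L) ⟩
      2 * suc L + ⌊ suc a ·φ⌋                      ∎) ,
    ℕ.+-cancelʳ-≤ ⌊ suc a ·φ⌋ _ _ (begin
      2 * suc L + ⌊ suc a ·φ⌋                               ≡⟨ sym (ones-floor a (suc L)) ⟩
      ones a (suc L) + ⌊ suc (a + suc L) ·φ⌋                ≤⟨ ℕ.+-monoʳ-≤ (ones a (suc L)) (proj₂ (⌊⌋-+ a L)) ⟩
      ones a (suc L) + suc (⌊ suc a ·φ⌋ + ⌊ suc L ·φ⌋)      ≡⟨ lemma′ (ones a (suc L)) ⌊ suc a ·φ⌋ ⌊ suc L ·φ⌋ ⟩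
      suc (ones a (suc L) + ⌊ suc L ·φ⌋) + ⌊ suc a ·φ⌋      ∎)
    where
      open ℕ.≤-Reasoning
      lemma : ∀ g b a → g + b + a ≡ g + (a + b)
      lemma = ℕSolver.solve-∀
      lemma′ : ∀ g a b → g + suc (a + b) ≡ suc (g + b) + a
      lemma′ = ℕSolver.solve-∀

  ones-balanced : ∀ a b L → ones a L ≤ suc (ones b L)
  ones-balanced a b zero    = z≤n
  ones-balanced a b (suc L) = ℕ.+-cancelʳ-≤ ⌊ suc L ·φ⌋ _ _
    (ℕ.≤-trans (proj₁ (ones+⌊⌋-bounds a L)) (proj₂ (ones+⌊⌋-bounds b L)))

  SameCentre : ℕ → ℕ → ℕ → Set
  SameCentre a b L = ∀ k → L ≡ suc (2 * k) → F (a + k) ≡ F (b + k)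

  ones-snoc : ∀ a L → ones a (suc L) ≡ ones a L + F (a + L)
  ones-snoc a zero    = trans (ℕ.+-identityʳ (F a)) (cong F (sym (ℕ.+-identityʳ a)))
  ones-snoc a (suc L) = trans (cong (F a +_) (ones-snoc (suc a) L))
    (trans (sym (ℕ.+-assoc (F a) _ _)) (cong (λ z → F a + ones (suc a) L + F z) (sym (ℕ.+-suc a L))))

  ones-cong : ∀ a b L → (∀ t → t < L → F (a + t) ≡ F (b + t)) → ones a L ≡ ones b L
  ones-cong a b zero    _     = refl
  ones-cong a b (suc L) agree = cong₂ _+_
    (trans (cong F (sym (ℕ.+-identityʳ a))) (trans (agree 0 (s≤s z≤n)) (cong F (ℕ.+-identityʳ b))))
    (ones-cong (suc a) (suc b) L (λ t t<L →
      trans (cong F (sym (ℕ.+-suc a t))) (trans (agree (suc t) (s≤s t<L)) (cong F (ℕ.+-suc b t)))))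

  Mirror-inner : ∀ a L → Mirror F a (2 + L) → Mirror F (suc a) L
  Mirror-inner a L mirror t u t+u+1≡L =
    trans (cong F (sym (ℕ.+-suc a t)))
      (trans (mirror (suc t) (suc u) (trans (lemma t u) (cong (2 +_) t+u+1≡L))) (cong F (ℕ.+-suc a u)))
    where lemma : ∀ t u → suc t + suc u + 1 ≡ 2 + (t + u + 1)
          lemma = ℕSolver.solve-∀

  SameCentre-inner : ∀ a b L → SameCentre a b (2 + L) → SameCentre (suc a) (suc b) L
  SameCentre-inner a b L same k L≡ =
    trans (cong F (sym (ℕ.+-suc a k)))
      (trans (same (suc k) (trans (cong (2 +_) L≡) (sym (lemma k)))) (cong F (ℕ.+-suc b k)))
    where lemma : ∀ k → suc (2 * suc k) ≡ 2 + suc (2 * k)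
          lemma = ℕSolver.solve-∀

  Mirror-ends : ∀ a L → Mirror F a (2 + L) → F (a + suc L) ≡ F a
  Mirror-ends a L mirror = trans (mirror (suc L) 0 (lemma L)) (cong F (ℕ.+-identityʳ a))
    where lemma : ∀ L → suc L + 0 + 1 ≡ 2 + L
          lemma = ℕSolver.solve-∀

  ones-ends : ∀ a L → ones a (2 + L) ≡ F a + ones (suc a) L + F (a + suc L)
  ones-ends a L = trans (cong (F a +_) (ones-snoc (suc a) L))
    (trans (sym (ℕ.+-assoc (F a) _ _)) (cong (λ z → F a + ones (suc a) L + F z) (sym (ℕ.+-suc a L))))

  -- Two palindromes of F of the same length (with the same centre if the
  -- length is odd) are equal: peeling off equal inner parts, outer letters
  -- 0 and 1 would give two windows whose numbers of 1s differ by 2.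
  F-mirror-unique : ∀ L a b → Mirror F a L → Mirror F b L → SameCentre a b L →
                    ∀ t → t < L → F (a + t) ≡ F (b + t)
  F-mirror-unique zero          a b _ _ _    t       ()
  F-mirror-unique (suc zero)    a b _ _ same zero    _ = same 0 refl
  F-mirror-unique (suc zero)    a b _ _ _    (suc t) (s≤s ())
  F-mirror-unique (suc (suc L)) a b mirror-a mirror-b same = agree
    where
      inner : ∀ t → t < L → F (suc a + t) ≡ F (suc b + t)
      inner = F-mirror-unique L (suc a) (suc b) (Mirror-inner a L mirror-a) (Mirror-inner b L mirror-b)
                (SameCentre-inner a b L same)
      inner-ones : ones (suc a) L ≡ ones (suc b) L
      inner-ones = ones-cong (suc a) (suc b) L inner
      unbalanced : ∀ a b → Mirror F a (2 + L) → Mirror F b (2 + L) → ones (suc a) L ≡ ones (suc b) L →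
                   F a ≡ 0 → F b ≡ 1 → ⊥
      unbalanced a b mirror-a mirror-b same-inner Fa≡0 Fb≡1 = ℕ.<-irrefl refl
        (subst₂ (λ x y → x ≤ suc y) ones-b ones-a (ones-balanced b a (2 + L)))
        where
          ones-a : ones a (2 + L) ≡ ones (suc a) L
          ones-a = trans (ones-ends a L) (trans (cong₂ (λ x y → x + ones (suc a) L + y) Fa≡0
                     (trans (Mirror-ends a L mirror-a) Fa≡0)) (ℕ.+-identityʳ _))
          ones-b : ones b (2 + L) ≡ 2 + ones (suc a) L
          ones-b = trans (ones-ends b L) (trans (cong₂ (λ x y → x + ones (suc b) L + y) Fb≡1
                     (trans (Mirror-ends b L mirror-b) Fb≡1)) (trans (ℕ.+-comm _ 1) (cong (2 +_) (sym same-inner))))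
      outer : F a ≡ F b
      outer with F-binary a | F-binary b
      ... | inj₁ Fa≡0 | inj₁ Fb≡0 = trans Fa≡0 (sym Fb≡0)
      ... | inj₂ Fa≡1 | inj₂ Fb≡1 = trans Fa≡1 (sym Fb≡1)
      ... | inj₁ Fa≡0 | inj₂ Fb≡1 = ⊥-elim (unbalanced a b mirror-a mirror-b inner-ones Fa≡0 Fb≡1)
      ... | inj₂ Fa≡1 | inj₁ Fb≡0 = ⊥-elim (unbalanced b a mirror-b mirror-a (sym inner-ones) Fb≡0 Fa≡1)
      agree : ∀ t → t < 2 + L → F (a + t) ≡ F (b + t)
      agree zero    _ = trans (cong F (ℕ.+-identityʳ a)) (trans outer (cong F (sym (ℕ.+-identityʳ b))))
      agree (suc t) (s≤s t≤L) with ℕ.m≤n⇒m<n∨m≡n t≤L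
      ... | inj₁ t<L = trans (cong F (ℕ.+-suc a t)) (trans (inner t (ℕ.≤-pred t<L)) (cong F (sym (ℕ.+-suc b t))))
      ... | inj₂ refl = trans (Mirror-ends a L mirror-a) (trans outer (sym (Mirror-ends b L mirror-b)))

  data Parity : ℕ → Set where
    even : ∀ h → Parity (2 * h)
    odd  : ∀ h → Parity (suc (2 * h))

  2*suc : ∀ h → 2 * suc h ≡ 2 + 2 * h
  2*suc = ℕSolver.solve-∀

  parity : ∀ n → Parity n
  parity zero    = even 0
  parity (suc n) with parity n
  ... | even h = odd h
  ... | odd h  = subst Parity (2*suc h) (even (suc h))

  SM′-even : ∀ h → SM′ (2 * h) ≡ 0
  SM′-even = zeroInterleaved-even F

  SM′-odd : ∀ h → SM′ (suc (2 * h)) ≡ suc (F h)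
  SM′-odd = zeroInterleaved-odd F

  SM′-letters : ∀ j → SM′ j ≡ 0 ⊎ SM′ j ≡ 1 ⊎ SM′ j ≡ 2
  SM′-letters j with parity j
  ... | even h = inj₁ (SM′-even h)
  ... | odd h with F-binary h
  ...   | inj₁ F≡0 = inj₂ (inj₁ (trans (SM′-odd h) (cong suc F≡0)))
  ...   | inj₂ F≡1 = inj₂ (inj₂ (trans (SM′-odd h) (cong suc F≡1)))

  SM′-neighbours : ∀ j → SM′ j ≡ SM′ (suc j) → ⊥
  SM′-neighbours j with parity j
  ... | even h = λ eq → ℕ.0≢1+n (trans (sym (SM′-even h)) (trans eq (SM′-odd h)))
  ... | odd h  = λ eq → ℕ.1+n≢0 (trans (sym (SM′-odd h))
                    (trans eq (trans (cong SM′ (sym (2*suc h))) (SM′-even (suc h)))))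

  SM′-no-even-mirror : ∀ i k → Mirror SM′ i (2 * suc k) → ⊥
  SM′-no-even-mirror i k mirror = SM′-neighbours (i + k)
    (trans (mirror k (suc k) (lemma k)) (cong SM′ (ℕ.+-suc i k)))
    where lemma : ∀ k → k + suc k + 1 ≡ 2 * suc k
          lemma = ℕSolver.solve-∀

  SM′-at-even : ∀ {j} h → j ≡ 2 * h → SM′ j ≡ 0
  SM′-at-even h refl = SM′-even h

  SM′-at-odd : ∀ {j} h → j ≡ suc (2 * h) → SM′ j ≡ suc (F h)
  SM′-at-odd h refl = SM′-odd h

  mirror-even-start : ∀ a k → Mirror SM′ (2 * a) (suc (2 * k)) → Mirror F a k
  mirror-even-start a k mirror x y x+y+1≡k = ℕ.suc-injective
    (trans (sym (SM′-at-odd (a + x) (lemma a x)))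
      (trans (mirror (suc (2 * x)) (suc (2 * y)) (trans (lemma′ x y) (cong (λ z → suc (2 * z)) x+y+1≡k)))
        (SM′-at-odd (a + y) (lemma a y))))
    where lemma : ∀ a x → 2 * a + suc (2 * x) ≡ suc (2 * (a + x))
          lemma = ℕSolver.solve-∀
          lemma′ : ∀ x y → suc (2 * x) + suc (2 * y) + 1 ≡ suc (2 * (x + y + 1))
          lemma′ = ℕSolver.solve-∀

  mirror-odd-start : ∀ a k → Mirror SM′ (suc (2 * a)) (suc (2 * k)) → Mirror F a (suc k)
  mirror-odd-start a k mirror x y x+y+1≡k+1 = ℕ.suc-injective
    (trans (sym (SM′-at-odd (a + x) (lemma a x)))
      (trans (mirror (2 * x) (2 * y) (trans (lemma′ x y) (cong (λ z → suc (2 * z)) x+y≡k)))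
        (SM′-at-odd (a + y) (lemma a y))))
    where x+y≡k = ℕ.suc-injective (trans (ℕ.+-comm 1 (x + y)) x+y+1≡k+1)
          lemma : ∀ a x → suc (2 * a) + 2 * x ≡ suc (2 * (a + x))
          lemma = ℕSolver.solve-∀
          lemma′ : ∀ x y → 2 * x + 2 * y + 1 ≡ suc (2 * (x + y))
          lemma′ = ℕSolver.solve-∀

  unique-even-start : ∀ a a′ k → Mirror SM′ (2 * a) (suc (2 * k)) → Mirror SM′ (2 * a′) (suc (2 * k)) →
                      SM′ (2 * a + k) ≡ SM′ (2 * a′ + k) → ∀ t → t ≤ 2 * k → SM′ (2 * a + t) ≡ SM′ (2 * a′ + t)
  unique-even-start a a′ k mirror mirror′ centre t t≤2k with parity t
  ... | even h = trans (SM′-at-even (a + h) (lemma a h)) (sym (SM′-at-even (a′ + h) (lemma a′ h)))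
    where lemma : ∀ a h → 2 * a + 2 * h ≡ 2 * (a + h)
          lemma = ℕSolver.solve-∀
  ... | odd h = trans (SM′-at-odd (a + h) (lemma a h))
                  (trans (cong suc (F-mirror-unique k a a′ (mirror-even-start a k mirror) (mirror-even-start a′ k mirror′)
                                      same h (ℕ.*-cancelˡ-< 2 h k t≤2k)))
                    (sym (SM′-at-odd (a′ + h) (lemma a′ h))))
    where
      lemma : ∀ a h → 2 * a + suc (2 * h) ≡ suc (2 * (a + h))
      lemma = ℕSolver.solve-∀
      same : SameCentre a a′ k
      same c refl = ℕ.suc-injective (trans (sym (SM′-at-odd (a + c) (lemma a c)))
                      (trans centre (SM′-at-odd (a′ + c) (lemma a′ c))))

  unique-odd-start : ∀ a a′ k → Mirror SM′ (suc (2 * a)) (suc (2 * k)) → Mirror SM′ (suc (2 * a′)) (suc (2 * k)) →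
                     SM′ (suc (2 * a) + k) ≡ SM′ (suc (2 * a′) + k) →
                     ∀ t → t ≤ 2 * k → SM′ (suc (2 * a) + t) ≡ SM′ (suc (2 * a′) + t)
  unique-odd-start a a′ k mirror mirror′ centre t t≤2k with parity t
  ... | odd h = trans (SM′-at-even (suc (a + h)) (lemma a h)) (sym (SM′-at-even (suc (a′ + h)) (lemma a′ h)))
    where lemma : ∀ a h → suc (2 * a) + suc (2 * h) ≡ 2 * suc (a + h)
          lemma = ℕSolver.solve-∀
  ... | even h = trans (SM′-at-odd (a + h) (lemma a h))
                   (trans (cong suc (F-mirror-unique (suc k) a a′ (mirror-odd-start a k mirror) (mirror-odd-start a′ k mirror′)
                                       same h (s≤s (ℕ.*-cancelˡ-≤ 2 t≤2k))))
                     (sym (SM′-at-odd (a′ + h) (lemma a′ h))))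
    where
      lemma : ∀ a h → suc (2 * a) + 2 * h ≡ suc (2 * (a + h))
      lemma = ℕSolver.solve-∀
      same : SameCentre a a′ (suc k)
      same c refl = ℕ.suc-injective (trans (sym (SM′-at-odd (a + c) (lemma a c)))
                      (trans centre (SM′-at-odd (a′ + c) (lemma a′ c))))

  centres-of-opposite-parity : ∀ a a′ k → SM′ (2 * a + k) ≡ SM′ (suc (2 * a′) + k) → ⊥
  centres-of-opposite-parity a a′ k centre with parity k
  ... | even c = ℕ.0≢1+n (trans (sym (SM′-at-even (a + c) (lemma a c))) (trans centre (SM′-at-odd (a′ + c) (lemma′ a′ c))))
    where lemma : ∀ a c → 2 * a + 2 * c ≡ 2 * (a + c)
          lemma = ℕSolver.solve-∀
          lemma′ : ∀ a c → suc (2 * a) + 2 * c ≡ suc (2 * (a + c))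
          lemma′ = ℕSolver.solve-∀
  ... | odd c = ℕ.1+n≢0 (trans (sym (SM′-at-odd (a + c) (lemma a c))) (trans centre (SM′-at-even (suc (a′ + c)) (lemma′ a′ c))))
    where lemma : ∀ a c → 2 * a + suc (2 * c) ≡ suc (2 * (a + c))
          lemma = ℕSolver.solve-∀
          lemma′ : ∀ a c → suc (2 * a) + suc (2 * c) ≡ 2 * suc (a + c)
          lemma′ = ℕSolver.solve-∀

  SM′-mirror-unique : ∀ i i′ k → Mirror SM′ i (suc (2 * k)) → Mirror SM′ i′ (suc (2 * k)) →
                      SM′ (i + k) ≡ SM′ (i′ + k) → ∀ t → t ≤ 2 * k → SM′ (i + t) ≡ SM′ (i′ + t)
  SM′-mirror-unique i i′ k with parity i | parity i′
  ... | even a | even a′ = unique-even-start a a′ k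
  ... | odd a  | odd a′  = unique-odd-start a a′ k
  ... | even a | odd a′  = λ _ _ centre → ⊥-elim (centres-of-opposite-parity a a′ k centre)
  ... | odd a  | even a′ = λ _ _ centre → ⊥-elim (centres-of-opposite-parity a′ a k (sym centre))

  Symmetric : Word → ℕ → Set
  Symmetric x p = ∀ t u → t + u ≡ 2 * p → x t ≡ x u

  SM′-symmetric : ∀ p → (∀ a b → a + b + 1 ≡ p → F a ≡ F b) → Symmetric SM′ p
  SM′-symmetric p F-sym t u t+u≡2p with parity t | parity u
  ... | even a | even b = trans (SM′-even a) (sym (SM′-even b))
  ... | odd a  | odd b  = trans (SM′-odd a) (trans (cong suc (F-sym a b a+b+1≡p)) (sym (SM′-odd b)))
    where
      a+b+1≡p : a + b + 1 ≡ p
      a+b+1≡p = ℕ.*-cancelˡ-≡ _ _ 2 (trans (lemma a b) t+u≡2p)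
        where lemma : ∀ a b → 2 * (a + b + 1) ≡ suc (2 * a) + suc (2 * b)
              lemma = ℕSolver.solve-∀
  ... | even a | odd b  = ⊥-elim (ℕ.even≢odd p (a + b) (trans (sym t+u≡2p) (lemma a b)))
    where lemma : ∀ a b → 2 * a + suc (2 * b) ≡ suc (2 * (a + b))
          lemma = ℕSolver.solve-∀
  ... | odd a  | even b = ⊥-elim (ℕ.even≢odd p (a + b) (trans (sym t+u≡2p) (lemma a b)))
    where lemma : ∀ a b → suc (2 * a) + 2 * b ≡ suc (2 * (a + b))
          lemma = ℕSolver.solve-∀

  SM′-symmetric-fib : ∀ n p → p + 2 ≡ fib (suc n) → Symmetric SM′ p
  SM′-symmetric-fib n p p+2≡M = SM′-symmetric p (λ a b a+b+1≡p →
    F-mirror n a b (trans (lemma a b) (trans (cong (_+ 2) a+b+1≡p) p+2≡M)))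
    where lemma : ∀ a b → a + b + 3 ≡ a + b + 1 + 2
          lemma = ℕSolver.solve-∀

  fib-grows : ∀ n → suc n ≤ fib (suc (suc n))
  fib-grows zero    = s≤s z≤n
  fib-grows (suc n) = ℕ.≤-trans (s≤s (fib-grows n))
    (subst (_≤ fib (suc (suc n)) + fib (suc n)) (ℕ.+-comm (fib (suc (suc n))) 1)
      (ℕ.+-monoʳ-≤ (fib (suc (suc n))) (1≤fib n)))

  3*suc : ∀ j → 3 * suc j ≡ 3 + 3 * j
  3*suc = ℕSolver.solve-∀

  fib-parity : ∀ j → (∃[ a ] fib (3 * j) ≡ 2 * a) × (∃[ b ] fib (suc (3 * j)) ≡ suc (2 * b)) ×
                     (∃[ c ] fib (2 + 3 * j) ≡ suc (2 * c))
  fib-parity zero    = (0 , refl) , (0 , refl) , (0 , refl)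
  fib-parity (suc j) with fib-parity j
  ... | _ , (b , fib₁) , (c , fib₂) =
    (x , trans (cong fib (3*suc j)) fib₃) ,
    (x + c , trans (cong (λ m → fib (suc m)) (3*suc j)) fib₄) ,
    (x + c + x , trans (cong (λ m → fib (2 + m)) (3*suc j)) fib₅)
    where
      n = 3 * j
      x = suc (b + c)
      fib₃ : fib (3 + n) ≡ 2 * x
      fib₃ = trans (cong₂ _+_ fib₂ fib₁) (lemma b c)
        where lemma : ∀ b c → suc (2 * c) + suc (2 * b) ≡ 2 * suc (b + c)
              lemma = ℕSolver.solve-∀
      fib₄ : fib (4 + n) ≡ suc (2 * (x + c))
      fib₄ = trans (cong₂ _+_ fib₃ fib₂) (lemma x c)
        where lemma : ∀ x c → 2 * x + suc (2 * c) ≡ suc (2 * (x + c))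
              lemma = ℕSolver.solve-∀
      fib₅ : fib (5 + n) ≡ suc (2 * (x + c + x))
      fib₅ = trans (cong₂ _+_ fib₄ fib₃) (lemma (x + c) x)
        where lemma : ∀ y x → suc (2 * y) + 2 * x ≡ suc (2 * (y + x))
              lemma = ℕSolver.solve-∀

  F-odd-centre : ∀ n q → fib (suc n) ≡ 2 * q + 3 → F q + fib (suc (suc n)) ≡ suc (2 * suc ⌊ suc q ·φ⌋)
  F-odd-centre n q M≡ = begin
    F q + fib (suc (suc n))                         ≡⟨ cong (F q +_) (sym reflection) ⟩
    F q + (⌊ suc q ·φ⌋ + ⌊ 2 + q ·φ⌋ + 1)           ≡⟨ lemma (F q) ⌊ suc q ·φ⌋ ⌊ 2 + q ·φ⌋ ⟩
    F q + ⌊ 2 + q ·φ⌋ + ⌊ suc q ·φ⌋ + 1             ≡⟨ cong (λ z → z + ⌊ suc q ·φ⌋ + 1) (F-floor q) ⟩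
    2 + ⌊ suc q ·φ⌋ + ⌊ suc q ·φ⌋ + 1               ≡⟨ lemma′ ⌊ suc q ·φ⌋ ⟩
    suc (2 * suc ⌊ suc q ·φ⌋)                       ∎
    where
      open ≡-Reasoning
      reflection = ⌊⌋-reflection n q (suc q) (trans (lemma″ q) (sym M≡))
        where lemma″ : ∀ q → suc q + suc (suc q) ≡ 2 * q + 3
              lemma″ = ℕSolver.solve-∀
      lemma : ∀ f a b → f + (a + b + 1) ≡ f + b + a + 1
      lemma = ℕSolver.solve-∀
      lemma′ : ∀ a → 2 + a + a + 1 ≡ suc (2 * suc a)
      lemma′ = ℕSolver.solve-∀

  Centred : ℕ → ℕ → Set
  Centred c r = ∃[ p ] r ≤ p × Symmetric SM′ p × SM′ p ≡ c

  radius≤ : ∀ r p → 2 + 3 * r ≤ p + 2 → r ≤ p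
  radius≤ r p 3r+2≤p+2 = ℕ.+-cancelʳ-≤ 2 r p
    (ℕ.≤-trans (ℕ.+-monoˡ-≤ 2 (ℕ.m≤n*m r 3)) (subst (_≤ p + 2) (ℕ.+-comm 2 (3 * r)) 3r+2≤p+2))

  odd≥3 : ∀ {m b} → 3 ≤ m → m ≡ suc (2 * b) → ∃[ q ] m ≡ 2 * q + 3
  odd≥3 {b = zero}  (s≤s (s≤s _)) ()
  odd≥3 {b = suc q} _ m≡ = q , trans m≡ (lemma q)
    where lemma : ∀ q → suc (2 * suc q) ≡ 2 * q + 3
          lemma = ℕSolver.solve-∀

  odd-centred : ∀ n q r → fib (suc n) ≡ 2 * q + 3 → 3 + 3 * r ≤ fib (suc n) → Centred (suc (F q)) r
  odd-centred n q r M≡ grows =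
    suc (2 * q) , radius≤ r (suc (2 * q)) (ℕ.≤-trans (ℕ.n≤1+n _) (ℕ.≤-trans grows (ℕ.≤-reflexive (trans M≡ (sym (lemma q)))))) ,
    SM′-symmetric-fib n (suc (2 * q)) (trans (lemma q) (sym M≡)) , SM′-odd q
    where lemma : ∀ q → suc (2 * q) + 2 ≡ 2 * q + 3
          lemma = ℕSolver.solve-∀

  centred-0 : ∀ r → Centred 0 r
  centred-0 r = from-parity (proj₁ (fib-parity (suc r)))
    where
      grows : 2 + 3 * r ≤ fib (3 * suc r)
      grows = subst (2 + 3 * r ≤_) (cong fib (sym (3*suc r))) (fib-grows (suc (3 * r)))
      from-parity : ∃[ a ] fib (3 * suc r) ≡ 2 * a → Centred 0 r
      from-parity (zero , M≡0)  = ⊥-elim (ℕ.<-irrefl (sym M≡0) (ℕ.<-≤-trans (s≤s z≤n) grows))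
      from-parity (suc a , M≡) =
        2 * a , radius≤ r (2 * a) (ℕ.≤-trans grows (ℕ.≤-reflexive (trans M≡ (sym (lemma a))))) ,
        SM′-symmetric-fib (2 + 3 * r) (2 * a) (trans (lemma a) (trans (sym M≡) (cong fib (3*suc r)))) , SM′-even a
        where lemma : ∀ a → 2 * a + 2 ≡ 2 * suc a
              lemma = ℕSolver.solve-∀

  centred-1 : ∀ r → Centred 1 r
  centred-1 r = from-parity (proj₁ (proj₂ (fib-parity (suc r)))) (proj₂ (proj₂ (fib-parity (suc r))))
    where
      n = 3 * suc r
      grows : 3 + 3 * r ≤ fib (suc n)
      grows = subst (3 + 3 * r ≤_) (cong (λ m → fib (suc m)) (sym (3*suc r))) (fib-grows (2 + 3 * r))
      from-parity : ∃[ b ] fib (suc n) ≡ suc (2 * b) → ∃[ c ] fib (2 + n) ≡ suc (2 * c) → Centred 1 r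
      from-parity (b , M≡) (c , N≡) = from-odd (odd≥3 {b = b} (ℕ.≤-trans (s≤s (s≤s (s≤s z≤n))) grows) M≡)
        where
          from-odd : ∃[ q ] fib (suc n) ≡ 2 * q + 3 → Centred 1 r
          from-odd (q , M≡′) = subst (λ c → Centred (suc c) r) Fq≡0 (odd-centred n q r M≡′ grows)
            where
              Fq≡0 : F q ≡ 0
              Fq≡0 with F-binary q
              ... | inj₁ F≡0 = F≡0
              ... | inj₂ F≡1 = ⊥-elim (ℕ.even≢odd (suc c) (suc ⌊ suc q ·φ⌋)
                                 (trans (lemma c) (trans (cong₂ _+_ (sym F≡1) (sym N≡)) (F-odd-centre n q M≡′))))
                where lemma : ∀ c → 2 * suc c ≡ 1 + suc (2 * c)
                      lemma = ℕSolver.solve-∀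

  centred-2 : ∀ r → Centred 2 r
  centred-2 r = from-parity (proj₂ (proj₂ (fib-parity (suc r)))) (proj₁ (fib-parity (suc (suc r))))
    where
      n = suc (3 * suc r)
      grows : 3 + 3 * r ≤ fib (suc n)
      grows = ℕ.≤-trans (ℕ.n≤1+n _)
        (subst (4 + 3 * r ≤_) (cong (λ m → fib (2 + m)) (sym (3*suc r))) (fib-grows (3 + 3 * r)))
      from-parity : ∃[ c ] fib (suc n) ≡ suc (2 * c) → ∃[ a ] fib (3 * suc (suc r)) ≡ 2 * a → Centred 2 r
      from-parity (c , M≡) (a , N≡) = from-odd (odd≥3 {b = c} (ℕ.≤-trans (s≤s (s≤s (s≤s z≤n))) grows) M≡)
        where
          from-odd : ∃[ q ] fib (suc n) ≡ 2 * q + 3 → Centred 2 r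
          from-odd (q , M≡′) = subst (λ c → Centred (suc c) r) Fq≡1 (odd-centred n q r M≡′ grows)
            where
              N≡′ : fib (suc (suc n)) ≡ 2 * a
              N≡′ = trans (cong fib (sym (3*suc (suc r)))) N≡
              Fq≡1 : F q ≡ 1
              Fq≡1 with F-binary q
              ... | inj₂ F≡1 = F≡1
              ... | inj₁ F≡0 = ⊥-elim (ℕ.even≢odd a (suc ⌊ suc q ·φ⌋)
                                 (trans (cong₂ _+_ (sym F≡0) (sym N≡′)) (F-odd-centre n q M≡′)))

module PalindromicComplexity where

  open import Data.Nat using (ℕ; zero; suc; _+_; _*_; _∸_; _<_; z≤n; s≤s)
  import Data.Nat.Properties as ℕ
  import Data.Nat.Tactic.RingSolver as ℕSolver
  open import Data.List using (List; []; _∷_; map; length; lookup; applyUpTo; upTo)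
  import Data.List.Properties as List
  open import Data.List.Relation.Unary.All using ([]; _∷_)
  open import Data.List.Relation.Unary.Any using (here; there)
  open import Data.List.Relation.Unary.AllPairs using ([]; _∷_)
  open import Data.List.Membership.Propositional using (_∈_)
  open import Data.Fin using (Fin; toℕ; fromℕ<; opposite)
  import Data.Fin.Properties as Fin
  open import Data.Product using (∃-syntax; _×_; _,_; proj₁; proj₂)
  open import Data.Sum using (_⊎_; inj₁; inj₂)
  open import Data.Empty using (⊥; ⊥-elim)
  open import Relation.Binary.PropositionalEquality
    using (_≡_; _≢_; refl; sym; trans; cong; cong₂; subst)
  open import Defs
  open Substitution using (SM′; SM≡SM′)
  open Palindromes

  nth-map-applyUpTo : ∀ (f g : ℕ → ℕ) n t → t < n → nth (map f (applyUpTo g n)) t ≡ f (g t)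
  nth-map-applyUpTo f g (suc n) zero    _       = refl
  nth-map-applyUpTo f g (suc n) (suc t) (s≤s t<n) = nth-map-applyUpTo f (λ z → g (suc z)) n t t<n

  nth-factorAt : ∀ x i n t → t < n → nth (factorAt x i n) t ≡ x (i + t)
  nth-factorAt x i n = nth-map-applyUpTo (λ j → x (i + j)) (λ z → z) n

  length-factorAt : ∀ x i n → length (factorAt x i n) ≡ n
  length-factorAt x i n = trans (List.length-map _ (upTo n)) (List.length-upTo n)

  lookup≡nth : ∀ (xs : List ℕ) k → lookup xs k ≡ nth xs (toℕ k)
  lookup≡nth (x ∷ xs) Fin.zero    = refl
  lookup≡nth (x ∷ xs) (Fin.suc k) = lookup≡nth xs k

  nth-ext : ∀ xs ys → length xs ≡ length ys → (∀ t → t < length xs → nth xs t ≡ nth ys t) → xs ≡ ys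
  nth-ext []       []       _   _     = refl
  nth-ext (x ∷ xs) (y ∷ ys) len agree =
    cong₂ _∷_ (agree 0 (s≤s z≤n)) (nth-ext xs ys (ℕ.suc-injective len) (λ t t<n → agree (suc t) (s≤s t<n)))

  factorAt-cong : ∀ x i i′ n → (∀ t → t < n → x (i + t) ≡ x (i′ + t)) → factorAt x i n ≡ factorAt x i′ n
  factorAt-cong x i i′ n agree = nth-ext _ _ (trans (length-factorAt x i n) (sym (length-factorAt x i′ n)))
    λ t t<len → let t<n = subst (t <_) (length-factorAt x i n) t<len in
      trans (nth-factorAt x i n t t<n) (trans (agree t t<n) (sym (nth-factorAt x i′ n t t<n)))

  mirror-index : ∀ {t u n} → t + u + 1 ≡ n → t < n
  mirror-index {t} {u} refl = subst (t <_) (ℕ.+-comm 1 (t + u)) (s≤s (ℕ.m≤m+n t u))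

  Palindrome⇒Mirror : ∀ x i n → Palindrome (factorAt x i n) → Mirror x i n
  Palindrome⇒Mirror x i n palindrome t u t+u+1≡n = trans (sym at-t) (trans (palindrome k) at-u)
    where
      w = factorAt x i n
      t<n = mirror-index t+u+1≡n
      u<n = mirror-index {u} {t} (trans (cong (_+ 1) (ℕ.+-comm u t)) t+u+1≡n)
      k : Fin (length w)
      k = fromℕ< (subst (t <_) (sym (length-factorAt x i n)) t<n)
      at-t : lookup w k ≡ x (i + t)
      at-t = trans (lookup≡nth w k) (trans (cong (nth w) (Fin.toℕ-fromℕ< _)) (nth-factorAt x i n t t<n))
      opposite≡u : toℕ (opposite k) ≡ u
      opposite≡u = trans (Fin.opposite-prop k) (trans (cong₂ _∸_ (length-factorAt x i n) (cong suc (Fin.toℕ-fromℕ< _)))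
                     (trans (cong (_∸ suc t) (sym t+u+1≡n)) (lemma t u)))
        where lemma : ∀ t u → t + u + 1 ∸ suc t ≡ u
              lemma t u = trans (cong (_∸ suc t) (ℕ.+-comm (t + u) 1)) (ℕ.m+n∸m≡n (suc t) u)
      at-u : lookup w (opposite k) ≡ x (i + u)
      at-u = trans (lookup≡nth w (opposite k)) (trans (cong (nth w) opposite≡u) (nth-factorAt x i n u u<n))

  Mirror⇒Palindrome : ∀ x i n → Mirror x i n → Palindrome (factorAt x i n)
  Mirror⇒Palindrome x i n mirror k = trans (lookup≡nth w k) (trans (nth-factorAt x i n t t<n)
    (trans (mirror t u t+u+1≡n) (sym (trans (lookup≡nth w (opposite k)) (trans (cong (nth w) opposite≡u)
      (nth-factorAt x i n u (mirror-index {u} {t} (trans (cong (_+ 1) (ℕ.+-comm u t)) t+u+1≡n))))))))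
    where
      w = factorAt x i n
      t = toℕ k
      t<n : t < n
      t<n = subst (t <_) (length-factorAt x i n) (Fin.toℕ<n k)
      u = n ∸ suc t
      t+u+1≡n : t + u + 1 ≡ n
      t+u+1≡n = trans (ℕ.+-comm (t + u) 1) (ℕ.m+[n∸m]≡n t<n)
      opposite≡u : toℕ (opposite k) ≡ u
      opposite≡u = trans (Fin.opposite-prop k) (cong (_∸ suc t) (length-factorAt x i n))

  Mirror-SM⇒SM′ : ∀ i n → Mirror SM i n → Mirror SM′ i n
  Mirror-SM⇒SM′ i n mirror t u t+u+1≡n = trans (sym (SM≡SM′ (i + t))) (trans (mirror t u t+u+1≡n) (SM≡SM′ (i + u)))

  Mirror-SM′⇒SM : ∀ i n → Mirror SM′ i n → Mirror SM i n
  Mirror-SM′⇒SM i n mirror t u t+u+1≡n = trans (SM≡SM′ (i + t)) (trans (mirror t u t+u+1≡n) (sym (SM≡SM′ (i + u))))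

  palindromic-factor : ∀ n w → PalFactor SM n w → ∃[ i ] factorAt SM i n ≡ w × Mirror SM′ i n
  palindromic-factor n w (length≡n , (i , factor≡) , palindrome) =
    i , factor≡′ , Mirror-SM⇒SM′ i n (Palindrome⇒Mirror SM i n (subst Palindrome (sym factor≡′) palindrome))
    where
      factor≡′ : factorAt SM i n ≡ w
      factor≡′ = subst (λ m → factorAt SM i m ≡ w) length≡n factor≡

  no-even-palindromes : ∀ k → PalCount SM (2 * suc k) 0
  no-even-palindromes k = [] , [] , [] , (λ w palindrome → ⊥-elim (absent w palindrome)) , refl
    where
      absent : ∀ w → PalFactor SM (2 * suc k) w → ⊥
      absent w palindrome with palindromic-factor _ w palindrome
      ... | i , _ , mirror = SM′-no-even-mirror i k mirror

  module OddLength (k : ℕ) where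
    n = 2 * k + 1

    Mirror-odd : ∀ x i → Mirror x i n → Mirror x i (suc (2 * k))
    Mirror-odd x i = subst (Mirror x i) (ℕ.+-comm (2 * k) 1)

    module Witness {c} (centred : Centred c k) where
      p = proj₁ centred
      q = p ∸ k
      q+k≡p : q + k ≡ p
      q+k≡p = ℕ.m∸n+n≡m (proj₁ (proj₂ centred))

      word : List ℕ
      word = factorAt SM q n

      mirror : Mirror SM′ q n
      mirror t u t+u+1≡n = proj₁ (proj₂ (proj₂ centred)) (q + t) (q + u)
        (trans (lemma q t u) (trans (cong (λ s → 2 * q + s) t+u≡2k) (trans (sym (ℕ.*-distribˡ-+ 2 q k)) (cong (2 *_) q+k≡p))))
        where
          t+u≡2k : t + u ≡ 2 * k
          t+u≡2k = ℕ.+-cancelʳ-≡ 1 (t + u) (2 * k) t+u+1≡n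
          lemma : ∀ q t u → q + t + (q + u) ≡ 2 * q + (t + u)
          lemma = ℕSolver.solve-∀

      palindrome : PalFactor SM n word
      palindrome = length-factorAt SM q n , (q , cong (factorAt SM q) (length-factorAt SM q n)) ,
                   Mirror⇒Palindrome SM q n (Mirror-SM′⇒SM q n mirror)

      centre′ : SM′ (q + k) ≡ c
      centre′ = trans (cong SM′ q+k≡p) (proj₂ (proj₂ (proj₂ centred)))

      k<n : k < n
      k<n = mirror-index {k} {k} (cong (λ z → k + z + 1) (sym (ℕ.+-identityʳ k)))

      centre : nth word k ≡ c
      centre = trans (nth-factorAt SM q n k k<n) (trans (SM≡SM′ (q + k)) centre′)

      unique : ∀ i → Mirror SM′ i n → SM′ (i + k) ≡ c → factorAt SM i n ≡ word
      unique i mirror-i centre-i = factorAt-cong SM i q n λ t t<n →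
        trans (SM≡SM′ (i + t)) (trans (SM′-mirror-unique i q k (Mirror-odd SM′ i mirror-i) (Mirror-odd SM′ q mirror) (trans centre-i (sym centre′)) t
          (ℕ.≤-pred (subst (t <_) (ℕ.+-comm (2 * k) 1) t<n))) (sym (SM≡SM′ (q + t))))

    module W₀ = Witness (centred-0 k)
    module W₁ = Witness (centred-1 k)
    module W₂ = Witness (centred-2 k)

    words : List (List ℕ)
    words = W₀.word ∷ W₁.word ∷ W₂.word ∷ []

    different-centres : ∀ {u v a b} → nth u k ≡ a → nth v k ≡ b → a ≢ b → u ≢ v
    different-centres centre-u centre-v a≢b refl = a≢b (trans (sym centre-u) centre-v)

    complete : ∀ w → PalFactor SM n w → w ∈ words
    complete w palindrome = locate (palindromic-factor n w palindrome)
      where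
        locate : ∃[ i ] factorAt SM i n ≡ w × Mirror SM′ i n → w ∈ words
        locate (i , factor≡ , mirror) = by-centre (SM′-letters (i + k))
          where
            by-centre : SM′ (i + k) ≡ 0 ⊎ SM′ (i + k) ≡ 1 ⊎ SM′ (i + k) ≡ 2 → w ∈ words
            by-centre (inj₁ c≡0)        = here (trans (sym factor≡) (W₀.unique i mirror c≡0))
            by-centre (inj₂ (inj₁ c≡1)) = there (here (trans (sym factor≡) (W₁.unique i mirror c≡1)))
            by-centre (inj₂ (inj₂ c≡2)) = there (there (here (trans (sym factor≡) (W₂.unique i mirror c≡2))))

    odd-palindromes : PalCount SM n 3
    odd-palindromes =
      words ,
      ((different-centres W₀.centre W₁.centre (λ ()) ∷ different-centres W₀.centre W₂.centre (λ ()) ∷ []) ∷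
       (different-centres W₁.centre W₂.centre (λ ()) ∷ []) ∷ [] ∷ []) ,
      (W₀.palindrome ∷ W₁.palindrome ∷ W₂.palindrome ∷ []) ,
      complete ,
      refl

open import Data.Nat using (ℕ; suc; _+_; _*_)
open import Data.Product using (_×_; _,_)
open import Defs using (SM; PalCount)
open PalindromicComplexity using (no-even-palindromes; module OddLength)

theorem4p4 : ((k : ℕ) → PalCount SM (2 * suc k) 0) × ((k : ℕ) → PalCount SM (2 * k + 1) 3)
theorem4p4 = no-even-palindromes , OddLength.odd-palindromes
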